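{- Let $m\geq 3$ be an integer. For $3\leq k\leq 2^m-4$ let $\lambda_k$ be the number of $k$-subsets $B$ of $\mathbb{F}_{2^m}\setminus\{0\}$ with $\sum_{x\in B}x=0$ that contain a given pair of distinct elements of $\mathbb{F}_{2^m}\setminus\{0\}$ (independent of the pair), and let $\lambda_k'=2^{k-3}\lambda_k$ (the balance parameter of the group divisible design $(V_\alpha,U_{\alpha,2},U_{\alpha,k})$ described in the context). Set $\lambda_{2^m-3}':=0$. Then for each $3\leq k\leq 2^m-4$, $$\lambda_{k+1}'=\begin{cases} \frac{2^{m+1}-2k-2}{k-1}\lambda_k', & k\equiv 1,3\pmod 4,\\ \frac{2^{m+1}-2k-2}{k-1}\lambda_k'+2^{k-2}\binom{2^{m-1}-2}{k/2-1}, & k\equiv 2\pmod 4,\\ \frac{2^{m+1}-2k-2}{k-1}\lambda_k'-2^{k-2}\binom{2^{m-1}-2}{k/2-1}, & k\equiv 0\pmod 4;\end{cases}$$ equivalently, $$\lambda_{k+1}'=\frac{2^{m+1}-2k-2}{k-1}\lambda_k'-\cos\frac{k\pi}{2}\cdot 2^{k-2}\binom{2^{m-1}-2}{\lfloor k/2-1\rfloor}.$$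
   Context: $\mathbb{F}_{q}$ denotes the finite field with $q$ elements. For $\alpha\in\mathbb{F}_{2^{m+1}}\setminus\{0\}$, $V_\alpha=\mathbb{F}_{2^{m+1}}\setminus\{0,\alpha\}$, $U_{\alpha,2}=\{\{i,j\}\subseteq V_\alpha: i+j=\alpha\}$, and $U_{\alpha,k}=\{B\subseteq V_\alpha: |B|=k,\ \sum_{x\in B}x=\alpha,\ B\cap(B+\alpha)=\emptyset\}$; for $3\le k\le 2^m-4$, every pair of distinct elements of $V_\alpha$ not forming a set in $U_{\alpha,2}$ lies in exactly $2^{k-3}\lambda_k$ sets of $U_{\alpha,k}$. -}

module Defs where

open import Data.Bool using (Bool; true; false; _xor_)
open import Data.Bool.Properties using () renaming (_≟_ to _≟B_)
open import Data.Nat using (ℕ; zero; suc; _∸_; _^_; _*_; _≟_)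
open import Data.Vec using (Vec; []; _∷_; zipWith; replicate)
open import Data.Vec.Properties using (≡-dec)
open import Data.List using (List; []; _∷_; map; _++_; filter; length; foldr)
open import Data.List.Membership.DecPropositional using ()
import Data.List.Membership.DecPropositional as DecMem
open import Data.Product using (_×_)
open import Relation.Nullary using (¬_; _×-dec_; ¬?)
open import Relation.Binary.PropositionalEquality using (_≡_)
open import Relation.Binary.Definitions using (DecidableEquality)
open import Data.Integer using (ℤ; +_)

-- The additive group of F_{2^m}, identified with (Z/2)^m via a basis of
-- F_{2^m} over F_2: elements are bit vectors, addition is coordinatewise xor.
F2m : ℕ → Set
F2m m = Vec Bool m

_⊕_ : ∀ {m} → F2m m → F2m m → F2m m
_⊕_ = zipWith _xor_

𝟎 : ∀ {m} → F2m m
𝟎 = replicate _ false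

_≟F_ : ∀ {m} → DecidableEquality (F2m m)
_≟F_ = ≡-dec _≟B_

allElems : (m : ℕ) → List (F2m m)
allElems zero    = [] ∷ []
allElems (suc m) = map (false ∷_) (allElems m) ++ map (true ∷_) (allElems m)

nonzeroElems : (m : ℕ) → List (F2m m)
nonzeroElems m = filter (λ x → ¬? (x ≟F 𝟎)) (allElems m)

-- all sublists of a list; for a duplicate-free list these are exactly
-- its subsets, each listed once
sublists : ∀ {a} {A : Set a} → List A → List (List A)
sublists []       = [] ∷ []
sublists (x ∷ xs) = sublists xs ++ map (x ∷_) (sublists xs)

sumF : ∀ {m} → List (F2m m) → F2m m
sumF = foldr _⊕_ 𝟎

module _ {m : ℕ} where
  open DecMem (_≟F_ {m}) using (_∈?_)

  lambdaCount : (k : ℕ) → F2m m → F2m m → ℕ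
  lambdaCount k x y =
    length (filter (λ B → (length B ≟ k) ×-dec ((sumF B ≟F 𝟎) ×-dec ((x ∈? B) ×-dec (y ∈? B))))
                   (sublists (nonzeroElems m)))

lambda' : (m k : ℕ) → F2m m → F2m m → ℤ
lambda' m k x y with k ≟ (2 ^ m ∸ 3)
... | Relation.Nullary.yes _ = + 0
... | Relation.Nullary.no  _ = + (2 ^ (k ∸ 3) * lambdaCount k x y)

module Submission where

-- Write N = 2^m and let χ_c (c ∈ F_{2^m}) be the additive characters.  By Fourier
-- inversion, N times the number of k-subsets of a list L with sum s is the
-- z^k-coefficient of ∑_c χ_c(s) ∏_{g ∈ L} (1 + χ_c(g) z), and each product is
-- (1+z)^p (1−z)^q, where p and q count the g ∈ L with χ_c(g) = 1 and = −1.
-- Inclusion–exclusion on x, y ∈ B, together with the equidistribution of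
-- (χ_c(x), χ_c(y)) over {±1}², turns this into the closed form
--     N ∑_k λ_k z^k = N z⁴ (1−z) (1−z²)^a + z² (1+z)^{N−3} − z² (1−z)³ (1−z²)^a
-- with N = 2a + 6.  The first-order differential equations satisfied by (1+z)^{N−3}
-- and (1−z²)^a then give, coefficientwise,
--     (k−1) λ_{k+1} = (N−1−k) λ_k + (k−1) [z^{k−2}] (1−z²)^{a+1},
-- and the last coefficient is 0 or ±C(a+1, k/2−1) according to k mod 4.
-- Multiplying by 2^{k−2} gives the statement.

open import Defs

-- Integer operations are unqualified in this module but natural-number ones in the
-- theorem below, hence the separate scope.
module _ where

  open import Algebra.Bundles using (CommutativeRing)
  open import Data.Bool using (Bool; true; false; _xor_; _∧_; not; if_then_else_)
  import Data.Bool.Properties as Boolₚ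
  open import Data.Nat as ℕ using (ℕ; zero; suc; _^_; _∸_; _≡ᵇ_; _≤_; s≤s; _/_; _%_)
  import Data.Nat.Properties as ℕₚ
  open import Data.Nat.Combinatorics using (_C_; nCk+nC[k+1]≡[n+1]C[k+1])
  open import Data.Nat.DivMod using (m≡m%n+[m/n]*n; m*n/n≡m)
  import Data.Nat.Tactic.RingSolver as ℕ-Solver
  open import Data.Integer as ℤ using (ℤ; +_; -[1+_]; -_; _+_; _*_; _-_; 0ℤ; 1ℤ; -1ℤ)
  import Data.Integer.Properties as ℤₚ
  open import Data.Integer.Tactic.RingSolver using (solve-∀)
  open import Data.List using (List; []; _∷_; map; _++_; length; filter)
  import Data.List.Properties as Listₚ
  open import Data.Product using (_×_; _,_; proj₁; proj₂; ∃-syntax)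
  open import Data.Sum using (_⊎_; inj₁; inj₂)
  open import Data.Vec using ([]; _∷_)
  open import Function.Bundles using (mk⇔)
  open import Relation.Nullary using (Dec; does; yes; no; ¬?; _×-dec_; contradiction)
  open import Relation.Nullary.Decidable using (dec-true; dec-false; does-⇔)
  open import Relation.Binary.PropositionalEquality
  open ≡-Reasoning

  -- Sums and counts over lists

  ∑ : ∀ {A : Set} → List A → (A → ℤ) → ℤ
  ∑ []       f = 0ℤ
  ∑ (x ∷ xs) f = f x + ∑ xs f

  ∑-++ : ∀ {A : Set} (xs ys : List A) f → ∑ (xs ++ ys) f ≡ ∑ xs f + ∑ ys f
  ∑-++ []       ys f = sym (ℤₚ.+-identityˡ _)
  ∑-++ (x ∷ xs) ys f = trans (cong (_+_ (f x)) (∑-++ xs ys f)) (sym (ℤₚ.+-assoc (f x) _ _))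

  ∑-map : ∀ {A B : Set} (h : A → B) (xs : List A) f → ∑ (map h xs) f ≡ ∑ xs (λ x → f (h x))
  ∑-map h []       f = refl
  ∑-map h (x ∷ xs) f = cong (_+_ (f (h x))) (∑-map h xs f)

  ∑-cong : ∀ {A : Set} (xs : List A) {f g : A → ℤ} → (∀ x → f x ≡ g x) → ∑ xs f ≡ ∑ xs g
  ∑-cong []       f≗g = refl
  ∑-cong (x ∷ xs) f≗g = cong₂ _+_ (f≗g x) (∑-cong xs f≗g)

  ∑-+ : ∀ {A : Set} (xs : List A) f g → ∑ xs (λ x → f x + g x) ≡ ∑ xs f + ∑ xs g
  ∑-+ []       f g = refl
  ∑-+ (x ∷ xs) f g = trans (cong (_+_ (f x + g x)) (∑-+ xs f g)) (interchange (f x) (g x) (∑ xs f) (∑ xs g))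
    where interchange : ∀ a b c d → a + b + (c + d) ≡ a + c + (b + d)
          interchange = solve-∀

  ∑-sub : ∀ {A : Set} (xs : List A) f g → ∑ xs (λ x → f x - g x) ≡ ∑ xs f - ∑ xs g
  ∑-sub []       f g = refl
  ∑-sub (x ∷ xs) f g = trans (cong (_+_ (f x - g x)) (∑-sub xs f g)) (interchange (f x) (g x) (∑ xs f) (∑ xs g))
    where interchange : ∀ a b c d → a - b + (c - d) ≡ a + c - (b + d)
          interchange = solve-∀

  ∑-*ˡ : ∀ {A : Set} (xs : List A) u f → ∑ xs (λ x → u * f x) ≡ u * ∑ xs f
  ∑-*ˡ []       u f = sym (ℤₚ.*-zeroʳ u)
  ∑-*ˡ (x ∷ xs) u f = trans (cong (_+_ (u * f x)) (∑-*ˡ xs u f)) (sym (ℤₚ.*-distribˡ-+ u (f x) _))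

  ∑-const : ∀ {A : Set} (xs : List A) u → ∑ xs (λ _ → u) ≡ + length xs * u
  ∑-const []       u = sym (ℤₚ.*-zeroˡ u)
  ∑-const (x ∷ xs) u = trans (cong (_+_ u) (∑-const xs u)) (distrib u (+ length xs))
    where distrib : ∀ u n → u + n * u ≡ (1ℤ + n) * u
          distrib = solve-∀

  alternating-cong : ∀ {a b c d a′ b′ c′ d′ : ℤ} → a ≡ a′ → b ≡ b′ → c ≡ c′ → d ≡ d′ →
    a - b - c + d ≡ a′ - b′ - c′ + d′
  alternating-cong refl refl refl refl = refl

  𝟙 : Bool → ℕ
  𝟙 true  = 1
  𝟙 false = 0

  count : ∀ {A : Set} → (A → Bool) → List A → ℕ
  count p []       = 0
  count p (x ∷ xs) = 𝟙 (p x) ℕ.+ count p xs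

  count≡∑𝟙 : ∀ {A : Set} (p : A → Bool) xs → + count p xs ≡ ∑ xs (λ x → + 𝟙 (p x))
  count≡∑𝟙 p []       = refl
  count≡∑𝟙 p (x ∷ xs) = cong (_+_ (+ 𝟙 (p x))) (count≡∑𝟙 p xs)

  count-cong : ∀ {A : Set} {p q : A → Bool} xs → (∀ x → p x ≡ q x) → count p xs ≡ count q xs
  count-cong []       p≗q = refl
  count-cong (x ∷ xs) p≗q = cong₂ (λ b n → 𝟙 b ℕ.+ n) (p≗q x) (count-cong xs p≗q)

  count-++ : ∀ {A : Set} (p : A → Bool) xs ys → count p (xs ++ ys) ≡ count p xs ℕ.+ count p ys
  count-++ p []       ys = refl
  count-++ p (x ∷ xs) ys = trans (cong (𝟙 (p x) ℕ.+_) (count-++ p xs ys)) (sym (ℕₚ.+-assoc (𝟙 (p x)) _ _))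

  count-map : ∀ {A B : Set} (p : B → Bool) (f : A → B) xs → count p (map f xs) ≡ count (λ x → p (f x)) xs
  count-map p f []       = refl
  count-map p f (x ∷ xs) = cong (𝟙 (p (f x)) ℕ.+_) (count-map p f xs)

  count-false : ∀ {A : Set} (xs : List A) → count (λ _ → false) xs ≡ 0
  count-false []       = refl
  count-false (x ∷ xs) = count-false xs

  count-true : ∀ {A : Set} (xs : List A) → count (λ _ → true) xs ≡ length xs
  count-true []       = refl
  count-true (x ∷ xs) = cong suc (count-true xs)

  count+count-not : ∀ {A : Set} (p : A → Bool) xs → count p xs ℕ.+ count (λ x → not (p x)) xs ≡ length xs
  count+count-not p []       = refl
  count+count-not p (x ∷ xs) with p x
  ... | true  = cong suc (count+count-not p xs)
  ... | false = trans (ℕₚ.+-suc _ _) (cong suc (count+count-not p xs))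

  count-split : ∀ {A : Set} (r p : A → Bool) xs →
    count p xs ≡ count (λ x → not (r x) ∧ p x) xs ℕ.+ count (λ x → r x ∧ p x) xs
  count-split r p []       = refl
  count-split r p (x ∷ xs) with r x | p x
  ... | true  | true  = trans (cong suc (count-split r p xs)) (sym (ℕₚ.+-suc _ _))
  ... | true  | false = count-split r p xs
  ... | false | true  = cong suc (count-split r p xs)
  ... | false | false = count-split r p xs

  length-filter : ∀ {A : Set} {P : A → Set} (P? : ∀ x → Dec (P x)) xs →
    length (filter P? xs) ≡ count (λ x → does (P? x)) xs
  length-filter P? []       = refl
  length-filter P? (x ∷ xs) with does (P? x)
  ... | true  = cong suc (length-filter P? xs)
  ... | false = length-filter P? xs

  𝟙-inclusion-exclusion : ∀ p X Y →
    + 𝟙 (p ∧ X ∧ Y) ≡ + 𝟙 p - + 𝟙 (p ∧ not X) - + 𝟙 (p ∧ not Y) + + 𝟙 (p ∧ not X ∧ not Y)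
  𝟙-inclusion-exclusion true  true  true  = refl
  𝟙-inclusion-exclusion true  true  false = refl
  𝟙-inclusion-exclusion true  false true  = refl
  𝟙-inclusion-exclusion true  false false = refl
  𝟙-inclusion-exclusion false X     Y     = refl

  count-inclusion-exclusion : ∀ {A : Set} (p X Y : A → Bool) xs →
    + count (λ z → p z ∧ X z ∧ Y z) xs
      ≡ + count p xs - + count (λ z → p z ∧ not (X z)) xs - + count (λ z → p z ∧ not (Y z)) xs
        + + count (λ z → p z ∧ not (X z) ∧ not (Y z)) xs
  count-inclusion-exclusion p X Y []       = refl
  count-inclusion-exclusion p X Y (x ∷ xs) = begin
    + 𝟙 (p x ∧ X x ∧ Y x) + + count (λ z → p z ∧ X z ∧ Y z) xs
      ≡⟨ cong₂ _+_ (𝟙-inclusion-exclusion (p x) (X x) (Y x)) (count-inclusion-exclusion p X Y xs) ⟩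
    u₁ - u₂ - u₃ + u₄ + (c₁ - c₂ - c₃ + c₄)
      ≡⟨ regroup u₁ u₂ u₃ u₄ c₁ c₂ c₃ c₄ ⟩
    (u₁ + c₁) - (u₂ + c₂) - (u₃ + c₃) + (u₄ + c₄) ∎
    where
    u₁ = + 𝟙 (p x)
    u₂ = + 𝟙 (p x ∧ not (X x))
    u₃ = + 𝟙 (p x ∧ not (Y x))
    u₄ = + 𝟙 (p x ∧ not (X x) ∧ not (Y x))
    c₁ = + count p xs
    c₂ = + count (λ z → p z ∧ not (X z)) xs
    c₃ = + count (λ z → p z ∧ not (Y z)) xs
    c₄ = + count (λ z → p z ∧ not (X z) ∧ not (Y z)) xs
    regroup : ∀ u₁ u₂ u₃ u₄ c₁ c₂ c₃ c₄ →
              u₁ - u₂ - u₃ + u₄ + (c₁ - c₂ - c₃ + c₄) ≡ (u₁ + c₁) - (u₂ + c₂) - (u₃ + c₃) + (u₄ + c₄)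
    regroup = solve-∀

  count-sublists-∷ : ∀ {A : Set} (P : List A → Bool) a xs →
    count P (sublists (a ∷ xs)) ≡ count P (sublists xs) ℕ.+ count (λ B → P (a ∷ B)) (sublists xs)
  count-sublists-∷ P a xs = trans (count-++ P (sublists xs) _) (cong (count P (sublists xs) ℕ.+_) (count-map P (a ∷_) (sublists xs)))

  -- Elements and characters of F_{2^m}

  module _ {m : ℕ} where
    open import Data.List.Membership.DecPropositional (_≟F_ {m}) using (_∈?_)

    infix 4 _==_ _∈ᵇ_

    _==_ : F2m m → F2m m → Bool
    x == y = does (x ≟F y)

    _∈ᵇ_ : F2m m → List (F2m m) → Bool
    x ∈ᵇ B = does (x ∈? B)

    ==-refl : ∀ x → (x == x) ≡ true
    ==-refl x = dec-true (x ≟F x) refl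

    ==-sym : ∀ x y → (x == y) ≡ (y == x)
    ==-sym x y with x ≟F y
    ... | yes refl = sym (==-refl x)
    ... | no x≢y   = sym (dec-false (y ≟F x) (λ y≡x → x≢y (sym y≡x)))

    ==-≢ : ∀ {x y} → x ≢ y → (x == y) ≡ false
    ==-≢ {x} {y} = dec-false (x ≟F y)

  ⊕-identityʳ : ∀ {m} (x : F2m m) → x ⊕ 𝟎 ≡ x
  ⊕-identityʳ []      = refl
  ⊕-identityʳ (a ∷ x) = cong₂ _∷_ (Boolₚ.xor-identityʳ a) (⊕-identityʳ x)

  ⊕-cancelˡ : ∀ {m} (x y : F2m m) → x ⊕ (x ⊕ y) ≡ y
  ⊕-cancelˡ []      []      = refl
  ⊕-cancelˡ (a ∷ x) (b ∷ y) = cong₂ _∷_ (trans (sym (Boolₚ.xor-assoc a a b)) (cong (_xor b) (Boolₚ.xor-same a))) (⊕-cancelˡ x y)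

  ⊕≡𝟎⇒≡ : ∀ {m} {x y : F2m m} → x ⊕ y ≡ 𝟎 → x ≡ y
  ⊕≡𝟎⇒≡ {x = x} {y} x⊕y≡𝟎 = begin
    x           ≡⟨ sym (⊕-identityʳ x) ⟩
    x ⊕ 𝟎       ≡⟨ cong (x ⊕_) (sym x⊕y≡𝟎) ⟩
    x ⊕ (x ⊕ y) ≡⟨ ⊕-cancelˡ x y ⟩
    y ∎

  ⊕-==-transpose : ∀ {m} (a u s : F2m m) → (a ⊕ u == s) ≡ (u == a ⊕ s)
  ⊕-==-transpose a u s = does-⇔ (mk⇔ (λ e → trans (sym (⊕-cancelˡ a u)) (cong (a ⊕_) e))
                                       (λ e → trans (cong (a ⊕_) e) (⊕-cancelˡ a s)))
                                ((a ⊕ u) ≟F s) (u ≟F (a ⊕ s))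

  _without_ : ∀ {m} → List (F2m m) → F2m m → List (F2m m)
  []      without s = []
  (a ∷ L) without s = if a == s then L without s else a ∷ (L without s)

  count-without≡ : ∀ {m} (b : F2m m → Bool) L s → count b (L without s) ≡ count (λ z → not (z == s) ∧ b z) L
  count-without≡ b []      s = refl
  count-without≡ b (a ∷ L) s with a == s
  ... | true  = count-without≡ b L s
  ... | false = cong (𝟙 (b a) ℕ.+_) (count-without≡ b L s)

  count-without : ∀ {m} (L : List (F2m m)) s → count (_== s) L ≡ 1 → ∀ b → count b (L without s) ≡ count b L ∸ 𝟙 (b s)
  count-without L s once b = sym (begin
    count b L ∸ 𝟙 (b s)
      ≡⟨ cong (_∸ 𝟙 (b s)) (count-split (_== s) b L) ⟩
    count (λ z → not (z == s) ∧ b z) L ℕ.+ count (λ z → (z == s) ∧ b z) L ∸ 𝟙 (b s)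
      ≡⟨ cong₂ (λ u v → u ℕ.+ v ∸ 𝟙 (b s)) (sym (count-without≡ b L s)) (count-s (b s) (count-cong L b-at-s)) ⟩
    count b (L without s) ℕ.+ 𝟙 (b s) ∸ 𝟙 (b s)
      ≡⟨ ℕₚ.m+n∸n≡m (count b (L without s)) (𝟙 (b s)) ⟩
    count b (L without s) ∎)
    where
    b-at-s : ∀ z → (z == s) ∧ b z ≡ (z == s) ∧ b s
    b-at-s z with z ≟F s
    ... | yes refl = refl
    ... | no _     = refl
    count-s : ∀ β → count (λ z → (z == s) ∧ b z) L ≡ count (λ z → (z == s) ∧ β) L →
              count (λ z → (z == s) ∧ b z) L ≡ 𝟙 β
    count-s true  e = trans e (trans (count-cong L (λ z → Boolₚ.∧-identityʳ (z == s))) once)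
    count-s false e = trans e (trans (count-cong L (λ z → Boolₚ.∧-zeroʳ (z == s))) (count-false L))

  count-==-without : ∀ {m} (L : List (F2m m)) {s t} → s ≢ t → count (_== s) (L without t) ≡ count (_== s) L
  count-==-without L {s} {t} s≢t = trans (count-without≡ (_== s) L t) (count-cong L only-s)
    where
    only-s : ∀ z → not (z == t) ∧ (z == s) ≡ (z == s)
    only-s z with z ≟F s
    ... | yes refl = cong (λ b → not b ∧ true) (==-≢ s≢t)
    ... | no _     = Boolₚ.∧-zeroʳ _

  length-allElems : ∀ m → length (allElems m) ≡ 2 ^ m
  length-allElems zero    = refl
  length-allElems (suc m) = begin
    length (map (false ∷_) (allElems m) ++ map (true ∷_) (allElems m))
      ≡⟨ Listₚ.length-++ (map (false ∷_) (allElems m)) ⟩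
    length (map (false ∷_) (allElems m)) ℕ.+ length (map (true ∷_) (allElems m))
      ≡⟨ cong₂ ℕ._+_ (Listₚ.length-map (false ∷_) (allElems m)) (Listₚ.length-map (true ∷_) (allElems m)) ⟩
    length (allElems m) ℕ.+ length (allElems m)
      ≡⟨ cong₂ ℕ._+_ (length-allElems m) (trans (length-allElems m) (sym (ℕₚ.+-identityʳ (2 ^ m)))) ⟩
    2 ^ m ℕ.+ (2 ^ m ℕ.+ 0) ∎

  ∑-allElems-suc : ∀ m f →
    ∑ (allElems (suc m)) f ≡ ∑ (allElems m) (λ g → f (false ∷ g)) + ∑ (allElems m) (λ g → f (true ∷ g))
  ∑-allElems-suc m f = trans (∑-++ (map (false ∷_) (allElems m)) _ f)
    (cong₂ _+_ (∑-map (false ∷_) (allElems m) f) (∑-map (true ∷_) (allElems m) f))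

  count-allElems-== : ∀ m (a : F2m m) → count (_== a) (allElems m) ≡ 1
  count-allElems-== zero    []      = refl
  count-allElems-== (suc m) (b ∷ a) = begin
    count (_== (b ∷ a)) (map (false ∷_) (allElems m) ++ map (true ∷_) (allElems m))
      ≡⟨ count-++ (_== (b ∷ a)) (map (false ∷_) (allElems m)) _ ⟩
    count (_== (b ∷ a)) (map (false ∷_) (allElems m)) ℕ.+ count (_== (b ∷ a)) (map (true ∷_) (allElems m))
      ≡⟨ cong₂ ℕ._+_ (count-map (_== (b ∷ a)) (false ∷_) (allElems m)) (count-map (_== (b ∷ a)) (true ∷_) (allElems m)) ⟩
    count (λ g → (false ∷ g) == (b ∷ a)) (allElems m) ℕ.+ count (λ g → (true ∷ g) == (b ∷ a)) (allElems m)
      ≡⟨ halves b ⟩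
    1 ∎
    where
    halves : ∀ b → count (λ g → (false ∷ g) == (b ∷ a)) (allElems m) ℕ.+ count (λ g → (true ∷ g) == (b ∷ a)) (allElems m) ≡ 1
    halves false = cong₂ ℕ._+_ (count-allElems-== m a) (count-false (allElems m))
    halves true  = cong₂ ℕ._+_ (count-false (allElems m)) (count-allElems-== m a)

  count-allElems-without-𝟎 : ∀ m (b : F2m m → Bool) → count b (allElems m without 𝟎) ≡ count b (allElems m) ∸ 𝟙 (b 𝟎)
  count-allElems-without-𝟎 m = count-without (allElems m) 𝟎 (count-allElems-== m 𝟎)

  nonzeroElems≡allElems-without-𝟎 : ∀ m → nonzeroElems m ≡ allElems m without 𝟎
  nonzeroElems≡allElems-without-𝟎 m = filter≡without (allElems m)
    where
    filter≡without : ∀ L → filter (λ z → ¬? (z ≟F 𝟎)) L ≡ L without 𝟎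
    filter≡without []      = refl
    filter≡without (a ∷ L) with a ≟F 𝟎
    ... | yes _ = filter≡without L
    ... | no  _ = cong (a ∷_) (filter≡without L)

  ∑-allElems-update : ∀ m (f g : F2m m → ℤ) → (∀ c → c ≢ 𝟎 → f c ≡ g c) →
    ∑ (allElems m) f ≡ ∑ (allElems m) g + (f 𝟎 - g 𝟎)
  ∑-allElems-update m f g f≗g = begin
    ∑ all f                                             ≡⟨ ∑-cong all pointwise ⟩
    ∑ all (λ c → g c + (f 𝟎 - g 𝟎) * + 𝟙 (c == 𝟎))     ≡⟨ ∑-+ all g _ ⟩
    ∑ all g + ∑ all (λ c → (f 𝟎 - g 𝟎) * + 𝟙 (c == 𝟎)) ≡⟨ cong (_+_ (∑ all g)) (∑-*ˡ all (f 𝟎 - g 𝟎) _) ⟩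
    ∑ all g + (f 𝟎 - g 𝟎) * ∑ all (λ c → + 𝟙 (c == 𝟎)) ≡⟨ cong (λ n → ∑ all g + (f 𝟎 - g 𝟎) * n)
                                                             (trans (sym (count≡∑𝟙 (_== 𝟎) all)) (cong +_ (count-allElems-== m 𝟎))) ⟩
    ∑ all g + (f 𝟎 - g 𝟎) * 1ℤ                          ≡⟨ cong (_+_ (∑ all g)) (ℤₚ.*-identityʳ _) ⟩
    ∑ all g + (f 𝟎 - g 𝟎) ∎
    where
    all = allElems m
    pointwise : ∀ c → f c ≡ g c + (f 𝟎 - g 𝟎) * + 𝟙 (c == 𝟎)
    pointwise c with c ≟F 𝟎
    ... | yes refl = cancel (f 𝟎) (g 𝟎)
      where cancel : ∀ u v → u ≡ v + (u - v) * 1ℤ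
            cancel = solve-∀
    ... | no c≢𝟎   = trans (f≗g c c≢𝟎) (sym (trans (cong (_+_ (g c)) (ℤₚ.*-zeroʳ (f 𝟎 - g 𝟎))) (ℤₚ.+-identityʳ (g c))))

  infixl 7 _·_

  _·_ : ∀ {m} → F2m m → F2m m → Bool
  []      · []      = false
  (a ∷ c) · (b ∷ g) = (a ∧ b) xor (c · g)

  ·-comm : ∀ {m} (c g : F2m m) → c · g ≡ g · c
  ·-comm []      []      = refl
  ·-comm (a ∷ c) (b ∷ g) = cong₂ _xor_ (Boolₚ.∧-comm a b) (·-comm c g)

  ·-zeroʳ : ∀ {m} (c : F2m m) → c · 𝟎 ≡ false
  ·-zeroʳ []      = refl
  ·-zeroʳ (a ∷ c) = trans (cong (_xor (c · 𝟎)) (Boolₚ.∧-zeroʳ a)) (·-zeroʳ c)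

  ·-zeroˡ : ∀ {m} (g : F2m m) → 𝟎 · g ≡ false
  ·-zeroˡ g = trans (·-comm 𝟎 g) (·-zeroʳ g)

  ·-distribˡ-⊕ : ∀ {m} (c g h : F2m m) → c · (g ⊕ h) ≡ (c · g) xor (c · h)
  ·-distribˡ-⊕ []      []      []      = refl
  ·-distribˡ-⊕ (a ∷ c) (b ∷ g) (d ∷ h) = begin
    (a ∧ (b xor d)) xor (c · (g ⊕ h))               ≡⟨ cong₂ _xor_ (Boolₚ.∧-distribˡ-xor a b d) (·-distribˡ-⊕ c g h) ⟩
    ((a ∧ b) xor (a ∧ d)) xor ((c · g) xor (c · h)) ≡⟨ xor-interchange (a ∧ b) (a ∧ d) (c · g) (c · h) ⟩
    ((a ∧ b) xor (c · g)) xor ((a ∧ d) xor (c · h)) ∎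
    where open import Algebra.Properties.CommutativeSemigroup
            (CommutativeRing.+-commutativeSemigroup Boolₚ.xor-∧-commutativeRing)
            using () renaming (interchange to xor-interchange)

  sgn : Bool → ℤ
  sgn false = 1ℤ
  sgn true  = -1ℤ

  sgn-xor : ∀ a b → sgn (a xor b) ≡ sgn a * sgn b
  sgn-xor false b     = sym (ℤₚ.*-identityˡ (sgn b))
  sgn-xor true  false = refl
  sgn-xor true  true  = refl

  χ : ∀ {m} → F2m m → F2m m → ℤ
  χ c g = sgn (c · g)

  χ-⊕ : ∀ {m} (c g h : F2m m) → χ c (g ⊕ h) ≡ χ c g * χ c h
  χ-⊕ c g h = trans (cong sgn (·-distribˡ-⊕ c g h)) (sgn-xor (c · g) (c · h))

  ∑-χ : ∀ m (c : F2m m) → c ≢ 𝟎 → ∑ (allElems m) (χ c) ≡ 0ℤ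
  ∑-χ zero    []          c≢𝟎 = contradiction refl c≢𝟎
  ∑-χ (suc m) (false ∷ c) c≢𝟎 = begin
    ∑ (allElems (suc m)) (χ (false ∷ c))         ≡⟨ ∑-allElems-suc m (χ (false ∷ c)) ⟩
    ∑ (allElems m) (χ c) + ∑ (allElems m) (χ c) ≡⟨ cong₂ _+_ half≡0 half≡0 ⟩
    0ℤ ∎
    where half≡0 = ∑-χ m c (λ c≡𝟎 → c≢𝟎 (cong (false ∷_) c≡𝟎))
  ∑-χ (suc m) (true ∷ c)  c≢𝟎 = begin
    ∑ (allElems (suc m)) (χ (true ∷ c))                                   ≡⟨ ∑-allElems-suc m (χ (true ∷ c)) ⟩
    ∑ (allElems m) (χ c) + ∑ (allElems m) (λ g → sgn (true xor (c · g))) ≡⟨ cong (_+_ (∑ (allElems m) (χ c)))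
                                                                               (∑-cong (allElems m) (λ g → sgn-xor true (c · g))) ⟩
    ∑ (allElems m) (χ c) + ∑ (allElems m) (λ g → -1ℤ * χ c g)            ≡⟨ cong (_+_ (∑ (allElems m) (χ c))) (∑-*ˡ (allElems m) -1ℤ (χ c)) ⟩
    ∑ (allElems m) (χ c) + -1ℤ * ∑ (allElems m) (χ c)                    ≡⟨ cancel (∑ (allElems m) (χ c)) ⟩
    0ℤ ∎
    where cancel : ∀ s → s + -1ℤ * s ≡ 0ℤ
          cancel = solve-∀

  ∑-χ-at : ∀ m (g : F2m m) → g ≢ 𝟎 → ∑ (allElems m) (λ c → χ c g) ≡ 0ℤ
  ∑-χ-at m g g≢𝟎 = trans (∑-cong (allElems m) (λ c → cong sgn (·-comm c g))) (∑-χ m g g≢𝟎)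

  ∑-χ-at-𝟎 : ∀ m → ∑ (allElems m) (λ c → χ c 𝟎) ≡ + (2 ^ m)
  ∑-χ-at-𝟎 m = begin
    ∑ (allElems m) (λ c → χ c 𝟎) ≡⟨ ∑-cong (allElems m) (λ c → cong sgn (·-zeroʳ c)) ⟩
    ∑ (allElems m) (λ _ → 1ℤ)    ≡⟨ ∑-const (allElems m) 1ℤ ⟩
    + length (allElems m) * 1ℤ   ≡⟨ trans (ℤₚ.*-identityʳ _) (cong +_ (length-allElems m)) ⟩
    + (2 ^ m) ∎

  ∑-χ≡count : ∀ {m} (c : F2m m) xs → ∑ xs (χ c) ≡ + count (λ g → not (c · g)) xs - + count (c ·_) xs
  ∑-χ≡count c xs = begin
    ∑ xs (χ c)                                                ≡⟨ ∑-cong xs (λ g → sgn≡𝟙 (c · g)) ⟩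
    ∑ xs (λ g → + 𝟙 (not (c · g)) - + 𝟙 (c · g))              ≡⟨ ∑-sub xs _ _ ⟩
    ∑ xs (λ g → + 𝟙 (not (c · g))) - ∑ xs (λ g → + 𝟙 (c · g)) ≡⟨ sym (cong₂ _-_ (count≡∑𝟙 _ xs) (count≡∑𝟙 _ xs)) ⟩
    + count (λ g → not (c · g)) xs - + count (c ·_) xs ∎
    where
    sgn≡𝟙 : ∀ b → sgn b ≡ + 𝟙 (not b) - + 𝟙 b
    sgn≡𝟙 false = refl
    sgn≡𝟙 true  = refl

  count-·-balanced : ∀ M (c : F2m (suc M)) → c ≢ 𝟎 →
    count (c ·_) (allElems (suc M)) ≡ 2 ^ M × count (λ g → not (c · g)) (allElems (suc M)) ≡ 2 ^ M
  count-·-balanced M c c≢𝟎 = v≡2^M , trans u≡v v≡2^M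
    where
    all = allElems (suc M)
    u = count (λ g → not (c · g)) all
    v = count (c ·_) all
    u≡v : u ≡ v
    u≡v = ℤₚ.+-injective (ℤₚ.i-j≡0⇒i≡j (+ u) (+ v) (trans (sym (∑-χ≡count c all)) (∑-χ (suc M) c c≢𝟎)))
    v≡2^M : v ≡ 2 ^ M
    v≡2^M = ℕₚ.*-cancelˡ-≡ v (2 ^ M) 2 (begin
      v ℕ.+ (v ℕ.+ 0) ≡⟨ cong (v ℕ.+_) (trans (ℕₚ.+-identityʳ v) (sym u≡v)) ⟩
      v ℕ.+ u         ≡⟨ count+count-not (c ·_) all ⟩
      length all      ≡⟨ length-allElems (suc M) ⟩
      2 ^ suc M ∎)

  count-·-without-𝟎 : ∀ M (c : F2m (suc M)) → c ≢ 𝟎 →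
    count (λ g → not (c · g)) (allElems (suc M) without 𝟎) ≡ 2 ^ M ∸ 1 × count (c ·_) (allElems (suc M) without 𝟎) ≡ 2 ^ M
  count-·-without-𝟎 M c c≢𝟎 with count-·-balanced M c c≢𝟎
  ... | minus≡ , plus≡ =
    trans (count-allElems-without-𝟎 (suc M) _) (cong₂ _∸_ plus≡ (cong (λ b → 𝟙 (not b)) (·-zeroʳ c))) ,
    trans (count-allElems-without-𝟎 (suc M) _) (cong₂ _∸_ minus≡ (cong 𝟙 (·-zeroʳ c)))

  count-𝟎·-without-𝟎 : ∀ m →
    count (λ g → not (𝟎 · g)) (allElems m without 𝟎) ≡ 2 ^ m ∸ 1 × count (𝟎 ·_) (allElems m without 𝟎) ≡ 0
  count-𝟎·-without-𝟎 m =
    trans (count-allElems-without-𝟎 m _)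
      (cong₂ _∸_ (trans (count-cong all (λ g → cong not (·-zeroˡ g))) (trans (count-true all) (length-allElems m)))
                 (cong (λ b → 𝟙 (not b)) (·-zeroʳ 𝟎ₘ))) ,
    trans (count-allElems-without-𝟎 m _)
      (trans (cong (_∸ 𝟙 (𝟎ₘ · 𝟎)) (trans (count-cong all ·-zeroˡ) (count-false all))) (ℕₚ.0∸n≡0 (𝟙 (𝟎ₘ · 𝟎))))
    where
    all = allElems m
    𝟎ₘ : F2m m
    𝟎ₘ = 𝟎

  fourier-on-pairs : ∀ (φ : Bool → Bool → ℤ) e d → + 4 * φ e d ≡
    (φ true true + φ true false + φ false true + φ false false)
      + (φ false true + φ false false - φ true true - φ true false) * sgn e
      + (φ true false + φ false false - φ true true - φ false true) * sgn d
      + (φ true true + φ false false - φ true false - φ false true) * (sgn e * sgn d)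
  fourier-on-pairs φ true  true  = at-tt (φ true true) (φ true false) (φ false true) (φ false false)
    where at-tt : ∀ a b c d → + 4 * a ≡ (a + b + c + d) + (c + d - a - b) * -1ℤ + (b + d - a - c) * -1ℤ + (a + d - b - c) * (-1ℤ * -1ℤ)
          at-tt = solve-∀
  fourier-on-pairs φ true  false = at-tf (φ true true) (φ true false) (φ false true) (φ false false)
    where at-tf : ∀ a b c d → + 4 * b ≡ (a + b + c + d) + (c + d - a - b) * -1ℤ + (b + d - a - c) * 1ℤ + (a + d - b - c) * (-1ℤ * 1ℤ)
          at-tf = solve-∀
  fourier-on-pairs φ false true  = at-ft (φ true true) (φ true false) (φ false true) (φ false false)
    where at-ft : ∀ a b c d → + 4 * c ≡ (a + b + c + d) + (c + d - a - b) * 1ℤ + (b + d - a - c) * -1ℤ + (a + d - b - c) * (1ℤ * -1ℤ)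
          at-ft = solve-∀
  fourier-on-pairs φ false false = at-ff (φ true true) (φ true false) (φ false true) (φ false false)
    where at-ff : ∀ a b c d → + 4 * d ≡ (a + b + c + d) + (c + d - a - b) * 1ℤ + (b + d - a - c) * 1ℤ + (a + d - b - c) * (1ℤ * 1ℤ)
          at-ff = solve-∀

  ∑-character-pair : ∀ m {x y : F2m m} → x ≢ 𝟎 → y ≢ 𝟎 → x ≢ y → (φ : Bool → Bool → ℤ) →
    + 4 * ∑ (allElems m) (λ c → φ (c · x) (c · y)) ≡ + (2 ^ m) * (φ true true + φ true false + φ false true + φ false false)
  ∑-character-pair m {x} {y} x≢𝟎 y≢𝟎 x≢y φ = begin
    + 4 * ∑ all (λ c → φ (c · x) (c · y))
      ≡⟨ sym (∑-*ˡ all (+ 4) _) ⟩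
    ∑ all (λ c → + 4 * φ (c · x) (c · y))
      ≡⟨ ∑-cong all (λ c → trans (fourier-on-pairs φ (c · x) (c · y))
                                 (cong (λ u → s₀ + s₁ * χ c x + s₂ * χ c y + s₃ * u) (sym (χ-⊕ c x y)))) ⟩
    ∑ all (λ c → s₀ + s₁ * χ c x + s₂ * χ c y + s₃ * χ c (x ⊕ y))
      ≡⟨ trans (∑-+ all _ _) (cong₂ _+_ (trans (∑-+ all _ _) (cong₂ _+_ (∑-+ all _ _) (∑-*ˡ all s₂ (λ c → χ c y))))
                                        (∑-*ˡ all s₃ (λ c → χ c (x ⊕ y)))) ⟩
    ∑ all (λ _ → s₀) + ∑ all (λ c → s₁ * χ c x) + s₂ * ∑ all (λ c → χ c y) + s₃ * ∑ all (λ c → χ c (x ⊕ y))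
      ≡⟨ cong₂ _+_ (cong₂ _+_ (cong₂ _+_ (∑-const all s₀) (∑-*ˡ all s₁ (λ c → χ c x))) (cong (s₂ *_) (∑-χ-at m y y≢𝟎)))
                   (cong (s₃ *_) (∑-χ-at m (x ⊕ y) (λ x⊕y≡𝟎 → x≢y (⊕≡𝟎⇒≡ x⊕y≡𝟎)))) ⟩
    + length all * s₀ + s₁ * ∑ all (λ c → χ c x) + s₂ * 0ℤ + s₃ * 0ℤ
      ≡⟨ cong₂ (λ n u → + n * s₀ + s₁ * u + s₂ * 0ℤ + s₃ * 0ℤ) (length-allElems m) (∑-χ-at m x x≢𝟎) ⟩
    + (2 ^ m) * s₀ + s₁ * 0ℤ + s₂ * 0ℤ + s₃ * 0ℤ
      ≡⟨ drop-zeros (+ (2 ^ m) * s₀) s₁ s₂ s₃ ⟩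
    + (2 ^ m) * s₀ ∎
    where
    all = allElems m
    s₀ = φ true true + φ true false + φ false true + φ false false
    s₁ = φ false true + φ false false - φ true true - φ true false
    s₂ = φ true false + φ false false - φ true true - φ false true
    s₃ = φ true true + φ false false - φ true false - φ false true
    drop-zeros : ∀ X s₁ s₂ s₃ → X + s₁ * 0ℤ + s₂ * 0ℤ + s₃ * 0ℤ ≡ X
    drop-zeros = solve-∀

  -- Coefficient sequences of polynomials in z

  -- A sequence f : Seq is read as the formal power series ∑_i f i zⁱ; all sequences
  -- used below vanish at negative indices.
  Seq : Set
  Seq = ℤ → ℤ

  infixl 6 _⊖_

  -- j ⊖ s is j − s, built so that (j ⊖ s) − 1 is definitionally j ⊖ suc s; shifted
  -- coefficients thus line up without index arithmetic.
  _⊖_ : ℤ → ℕ → ℤ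
  j ⊖ zero  = j
  j ⊖ suc s = j ⊖ s - 1ℤ

  δ : Seq
  δ (+ zero)  = 1ℤ
  δ (+ suc _) = 0ℤ
  δ -[1+ _ ]  = 0ℤ

  [1+z] [1-z] : Seq → Seq
  [1+z] f i = f i + f (i - 1ℤ)
  [1-z] f i = f i - f (i - 1ℤ)

  poly : ℕ → ℕ → Seq
  poly zero    zero    = δ
  poly zero    (suc q) = [1-z] (poly zero q)
  poly (suc p) q       = [1+z] (poly p q)

  [1+z]-cong : ∀ {f g} → f ≗ g → [1+z] f ≗ [1+z] g
  [1+z]-cong f≗g i = cong₂ _+_ (f≗g i) (f≗g (i - 1ℤ))

  [1-z]-cong : ∀ {f g} → f ≗ g → [1-z] f ≗ [1-z] g
  [1-z]-cong f≗g i = cong₂ _-_ (f≗g i) (f≗g (i - 1ℤ))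

  [1+z][1-z]-comm : ∀ f → [1+z] ([1-z] f) ≗ [1-z] ([1+z] f)
  [1+z][1-z]-comm f i = identity (f i) (f (i - 1ℤ)) (f (i - 1ℤ - 1ℤ))
    where identity : ∀ x y z → x - y + (y - z) ≡ x + y - (y + z)
          identity = solve-∀

  poly-suc-right : ∀ p q → poly p (suc q) ≗ [1-z] (poly p q)
  poly-suc-right zero    q i = refl
  poly-suc-right (suc p) q i = trans ([1+z]-cong (poly-suc-right p q) i) ([1+z][1-z]-comm (poly p q) i)

  poly-negative : ∀ p q j → poly p q -[1+ j ] ≡ 0ℤ
  poly-negative zero    zero    j = refl
  poly-negative zero    (suc q) j = cong₂ _-_ (poly-negative zero q j) (poly-negative zero q _)
  poly-negative (suc p) q       j = cong₂ _+_ (poly-negative p q j) (poly-negative p q _)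

  [1+z][1-z]-diff : ∀ f i → [1+z] ([1-z] f) i ≡ f i - f (i ⊖ 2)
  [1+z][1-z]-diff f i = identity (f i) (f (i - 1ℤ)) (f (i - 1ℤ - 1ℤ))
    where identity : ∀ x y z → x - y + (y - z) ≡ x - z
          identity = solve-∀

  -- Coefficientwise:  (1+z)² − 2(1+z) + 1 = z²,  (1−z)² − 2(1−z) + 1 = z²,
  -- (1+z)(1−z) − (1+z) − (1−z) + 1 = −z²  and  (1+z)² − 2(1+z)(1−z) + (1−z)² = 4z².
  [1+z]-twice : ∀ f i → [1+z] ([1+z] f) i - [1+z] f i - [1+z] f i + f i ≡ f (i ⊖ 2)
  [1+z]-twice f i = identity (f i) (f (i - 1ℤ)) (f (i - 1ℤ - 1ℤ))
    where identity : ∀ x y z → (x + y) + (y + z) - (x + y) - (x + y) + x ≡ z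
          identity = solve-∀

  [1-z]-twice : ∀ f i → [1-z] ([1-z] f) i - [1-z] f i - [1-z] f i + f i ≡ f (i ⊖ 2)
  [1-z]-twice f i = identity (f i) (f (i - 1ℤ)) (f (i - 1ℤ - 1ℤ))
    where identity : ∀ x y z → (x - y) - (y - z) - (x - y) - (x - y) + x ≡ z
          identity = solve-∀

  [1+z][1-z]-mixed : ∀ f i → [1+z] ([1-z] f) i - [1+z] f i - [1-z] f i + f i ≡ - f (i ⊖ 2)
  [1+z][1-z]-mixed f i = identity (f i) (f (i - 1ℤ)) (f (i - 1ℤ - 1ℤ))
    where identity : ∀ x y z → (x - y) + (y - z) - (x + y) - (x - y) + x ≡ - z
          identity = solve-∀

  [1±z]-squares : ∀ f i → [1+z] ([1+z] f) i - [1+z] ([1-z] f) i - [1+z] ([1-z] f) i + [1-z] ([1-z] f) i ≡ + 4 * f (i ⊖ 2)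
  [1±z]-squares f i = identity (f i) (f (i - 1ℤ)) (f (i - 1ℤ - 1ℤ))
    where identity : ∀ x y z → (x + y) + (y + z) - ((x - y) + (y - z)) - ((x - y) + (y - z)) + ((x - y) - (y - z)) ≡ + 4 * z
          identity = solve-∀

  -1^-double : ∀ u → -1ℤ ℤ.^ (u ℕ.+ u) ≡ 1ℤ
  -1^-double zero    = refl
  -1^-double (suc u) = begin
    -1ℤ * -1ℤ ℤ.^ (u ℕ.+ suc u)     ≡⟨ cong (λ n → -1ℤ * -1ℤ ℤ.^ n) (ℕₚ.+-suc u u) ⟩
    -1ℤ * (-1ℤ * -1ℤ ℤ.^ (u ℕ.+ u)) ≡⟨ sym (ℤₚ.*-assoc -1ℤ -1ℤ _) ⟩
    1ℤ * -1ℤ ℤ.^ (u ℕ.+ u)          ≡⟨ ℤₚ.*-identityˡ _ ⟩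
    -1ℤ ℤ.^ (u ℕ.+ u)               ≡⟨ -1^-double u ⟩
    1ℤ ∎

  poly-above : ∀ p q n → p ℕ.+ q ℕ.< n → poly p q (+ n) ≡ 0ℤ
  poly-above zero    zero    (suc n) _ = refl
  poly-above zero    (suc q) (suc n) 1+q<1+n = cong₂ _-_
    (poly-above zero q (suc n) (ℕₚ.<-trans (ℕₚ.n<1+n q) 1+q<1+n))
    (poly-above zero q n (ℕ.s<s⁻¹ 1+q<1+n))
  poly-above (suc p) q       (suc n) 1+p+q<1+n = cong₂ _+_
    (poly-above p q (suc n) (ℕₚ.<-trans (ℕₚ.n<1+n (p ℕ.+ q)) 1+p+q<1+n))
    (poly-above p q n (ℕ.s<s⁻¹ 1+p+q<1+n))

  poly-top : ∀ p q → poly p q (+ (p ℕ.+ q)) ≡ -1ℤ ℤ.^ q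
  poly-top zero    zero    = refl
  poly-top zero    (suc q) = begin
    poly zero q (+ suc q) - poly zero q (+ q) ≡⟨ cong₂ _-_ (poly-above zero q (suc q) (ℕₚ.n<1+n q)) (poly-top zero q) ⟩
    0ℤ - -1ℤ ℤ.^ q                              ≡⟨ ℤₚ.+-identityˡ _ ⟩
    - (-1ℤ ℤ.^ q)                               ≡⟨ sym (ℤₚ.-1*i≡-i (-1ℤ ℤ.^ q)) ⟩
    -1ℤ ℤ.^ suc q ∎
  poly-top (suc p) q       = begin
    poly p q (+ suc (p ℕ.+ q)) + poly p q (+ (p ℕ.+ q)) ≡⟨ cong₂ _+_ (poly-above p q _ (ℕₚ.n<1+n (p ℕ.+ q))) (poly-top p q) ⟩
    0ℤ + -1ℤ ℤ.^ q                                        ≡⟨ ℤₚ.+-identityˡ _ ⟩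
    -1ℤ ℤ.^ q ∎

  poly-diag-suc : ∀ b i → poly (suc b) (suc b) i ≡ poly b b i - poly b b (i ⊖ 2)
  poly-diag-suc b i = trans ([1+z]-cong (poly-suc-right b b) i) ([1+z][1-z]-diff (poly b b) i)

  poly-diag-even : ∀ b l → poly b b (+ (l ℕ.+ l)) ≡ -1ℤ ℤ.^ l * + (b C l)
  poly-diag-odd  : ∀ b l → poly b b (+ suc (l ℕ.+ l)) ≡ 0ℤ
  poly-diag-even zero    zero    = refl
  poly-diag-even zero    (suc l) = sym (ℤₚ.*-zeroʳ (-1ℤ ℤ.^ suc l))
  poly-diag-even (suc b) zero    = begin
    poly (suc b) (suc b) (+ 0)           ≡⟨ poly-diag-suc b (+ 0) ⟩
    poly b b (+ 0) - poly b b -[1+ 1 ]   ≡⟨ cong₂ _-_ (poly-diag-even b zero) (poly-negative b b 1) ⟩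
    1ℤ * + (b C 0) - 0ℤ                  ≡⟨ ℤₚ.+-identityʳ _ ⟩
    1ℤ * + (suc b C 0) ∎
  poly-diag-even (suc b) (suc l) = begin
    poly (suc b) (suc b) (+ (suc l ℕ.+ suc l))
      ≡⟨ poly-diag-suc b _ ⟩
    poly b b (+ (suc l ℕ.+ suc l)) - poly b b (+ (suc l ℕ.+ suc l) ⊖ 2)
      ≡⟨ cong₂ _-_ (poly-diag-even b (suc l)) (trans (cong (λ n → poly b b (+ n - 1ℤ)) (ℕₚ.+-suc l l)) (poly-diag-even b l)) ⟩
    -1ℤ ℤ.^ suc l * + (b C suc l) - -1ℤ ℤ.^ l * + (b C l)
      ≡⟨ identity (-1ℤ ℤ.^ l) (+ (b C suc l)) (+ (b C l)) ⟩
    -1ℤ ℤ.^ suc l * (+ (b C l) + + (b C suc l))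
      ≡⟨ cong (λ n → -1ℤ ℤ.^ suc l * + n) (nCk+nC[k+1]≡[n+1]C[k+1] b l) ⟩
    -1ℤ ℤ.^ suc l * + (suc b C suc l) ∎
    where identity : ∀ s x y → -1ℤ * s * x - s * y ≡ -1ℤ * s * (y + x)
          identity = solve-∀
  poly-diag-odd zero    l       = refl
  poly-diag-odd (suc b) zero    = trans (poly-diag-suc b (+ 1)) (cong₂ _-_ (poly-diag-odd b zero) (poly-negative b b 0))
  poly-diag-odd (suc b) (suc l) = trans (poly-diag-suc b _)
    (cong₂ _-_ (poly-diag-odd b (suc l)) (trans (cong (λ n → poly b b (+ n)) (ℕₚ.+-suc l l)) (poly-diag-odd b l)))

  k≡r+[k/4]*4 : ∀ k {r} → k % 4 ≡ r → k ≡ r ℕ.+ k / 4 ℕ.* 4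
  k≡r+[k/4]*4 k k%4≡r = trans (m≡m%n+[m/n]*n k 4) (cong (ℕ._+ k / 4 ℕ.* 4) k%4≡r)

  poly-diag-odd-index : ∀ b {n} l → n ≡ suc (l ℕ.+ l) → poly b b (+ n) ≡ 0ℤ
  poly-diag-odd-index b l refl = poly-diag-odd b l

  poly-diag-1mod4 : ∀ b k → 3 ≤ k → k % 4 ≡ 1 → poly b b (+ (k ∸ 2)) ≡ 0ℤ
  poly-diag-1mod4 b k 3≤k k%4≡1 with k / 4 | k≡r+[k/4]*4 k k%4≡1
  ... | zero   | refl = contradiction 3≤k λ { (s≤s ()) }
  ... | suc q  | refl = poly-diag-odd-index b (suc (q ℕ.+ q)) (index q)
    where index : ∀ q → 3 ℕ.+ q ℕ.* 4 ≡ suc (suc (q ℕ.+ q) ℕ.+ suc (q ℕ.+ q))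
          index = ℕ-Solver.solve-∀

  poly-diag-3mod4 : ∀ b k → k % 4 ≡ 3 → poly b b (+ (k ∸ 2)) ≡ 0ℤ
  poly-diag-3mod4 b k k%4≡3 with k / 4 | k≡r+[k/4]*4 k k%4≡3
  ... | q | refl = poly-diag-odd-index b (q ℕ.+ q) (index q)
    where index : ∀ q → 1 ℕ.+ q ℕ.* 4 ≡ suc (q ℕ.+ q ℕ.+ (q ℕ.+ q))
          index = ℕ-Solver.solve-∀

  poly-diag-even-index : ∀ b {n} l → n ≡ l ℕ.+ l → poly b b (+ n) ≡ -1ℤ ℤ.^ l * + (b C l)
  poly-diag-even-index b l refl = poly-diag-even b l

  half-index : ∀ {k} l → k ≡ suc l ℕ.* 2 → k / 2 ∸ 1 ≡ l
  half-index l refl = cong (_∸ 1) (m*n/n≡m (suc l) 2)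

  poly-diag-2mod4 : ∀ b k → k % 4 ≡ 2 → poly b b (+ (k ∸ 2)) ≡ + (b C (k / 2 ∸ 1))
  poly-diag-2mod4 b k k%4≡2 with k / 4 | k≡r+[k/4]*4 k k%4≡2
  ... | q | refl = begin
    poly b b (+ (q ℕ.* 4))                  ≡⟨ poly-diag-even-index b (q ℕ.+ q) (index q) ⟩
    -1ℤ ℤ.^ (q ℕ.+ q) * + (b C (q ℕ.+ q))    ≡⟨ cong (_* + (b C (q ℕ.+ q))) (-1^-double q) ⟩
    1ℤ * + (b C (q ℕ.+ q))                   ≡⟨ ℤₚ.*-identityˡ _ ⟩
    + (b C (q ℕ.+ q))                        ≡⟨ cong (λ l → + (b C l)) (sym (half-index (q ℕ.+ q) (double q))) ⟩
    + (b C ((2 ℕ.+ q ℕ.* 4) / 2 ∸ 1)) ∎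
    where
    index : ∀ q → q ℕ.* 4 ≡ q ℕ.+ q ℕ.+ (q ℕ.+ q)
    index = ℕ-Solver.solve-∀
    double : ∀ q → 2 ℕ.+ q ℕ.* 4 ≡ suc (q ℕ.+ q) ℕ.* 2
    double = ℕ-Solver.solve-∀

  poly-diag-0mod4 : ∀ b k → 3 ≤ k → k % 4 ≡ 0 → poly b b (+ (k ∸ 2)) ≡ - + (b C (k / 2 ∸ 1))
  poly-diag-0mod4 b k 3≤k k%4≡0 with k / 4 | k≡r+[k/4]*4 k k%4≡0
  ... | zero  | refl = contradiction 3≤k λ ()
  ... | suc q | refl = begin
    poly b b (+ (2 ℕ.+ q ℕ.* 4))                              ≡⟨ poly-diag-even-index b (suc (q ℕ.+ q)) (index q) ⟩
    -1ℤ * -1ℤ ℤ.^ (q ℕ.+ q) * + (b C (suc (q ℕ.+ q)))          ≡⟨ cong (λ s → -1ℤ * s * + (b C (suc (q ℕ.+ q)))) (-1^-double q) ⟩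
    -1ℤ * + (b C (suc (q ℕ.+ q)))                              ≡⟨ ℤₚ.-1*i≡-i _ ⟩
    - + (b C (suc (q ℕ.+ q)))                                  ≡⟨ cong (λ l → - + (b C l)) (sym (half-index (suc (q ℕ.+ q)) (double q))) ⟩
    - + (b C ((4 ℕ.+ q ℕ.* 4) / 2 ∸ 1)) ∎
    where
    index : ∀ q → 2 ℕ.+ q ℕ.* 4 ≡ suc (q ℕ.+ q) ℕ.+ suc (q ℕ.+ q)
    index = ℕ-Solver.solve-∀
    double : ∀ q → 4 ℕ.+ q ℕ.* 4 ≡ suc (suc (q ℕ.+ q)) ℕ.* 2
    double = ℕ-Solver.solve-∀

  poly-[1+z]-recurrence : ∀ p t → t * poly p 0 t ≡ (+ suc p - t) * poly p 0 (t - 1ℤ)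
  poly-[1+z]-recurrence zero    (+ zero)        = refl
  poly-[1+z]-recurrence zero    (+ suc zero)    = refl
  poly-[1+z]-recurrence zero    (+ suc (suc n)) = trans (ℤₚ.*-zeroʳ (+ suc (suc n))) (sym (ℤₚ.*-zeroʳ (+ 1 - + suc (suc n))))
  poly-[1+z]-recurrence zero    -[1+ n ]        = trans (ℤₚ.*-zeroʳ -[1+ n ]) (sym (ℤₚ.*-zeroʳ (+ 1 - -[1+ n ])))
  poly-[1+z]-recurrence (suc p) t               = begin
    t * (f t + f (t ⊖ 1))                                         ≡⟨ split t (f t) (f (t ⊖ 1)) ⟩
    t * f t + ((t ⊖ 1) * f (t ⊖ 1) + f (t ⊖ 1))                   ≡⟨ cong₂ (λ u v → u + (v + f (t ⊖ 1)))
                                                                       (poly-[1+z]-recurrence p t) (poly-[1+z]-recurrence p (t ⊖ 1)) ⟩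
    (P - t) * f (t ⊖ 1) + ((P - (t ⊖ 1)) * f (t ⊖ 2) + f (t ⊖ 1)) ≡⟨ collect t P (f (t ⊖ 1)) (f (t ⊖ 2)) ⟩
    (1ℤ + P - t) * (f (t ⊖ 1) + f (t ⊖ 2)) ∎
    where
    f = poly p 0
    P = + suc p
    split : ∀ t u v → t * (u + v) ≡ t * u + ((t - 1ℤ) * v + v)
    split = solve-∀
    collect : ∀ t P v w → (P - t) * v + ((P - (t - 1ℤ)) * w + v) ≡ (1ℤ + P - t) * (v + w)
    collect = solve-∀

  poly-[1-z²]-recurrence : ∀ b t → t * poly b b t ≡ (t - + 2 - (+ b + + b)) * poly b b (t ⊖ 2)
  poly-[1-z²]-recurrence zero    (+ zero)              = refl
  poly-[1-z²]-recurrence zero    (+ suc zero)          = refl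
  poly-[1-z²]-recurrence zero    (+ suc (suc zero))    = refl
  poly-[1-z²]-recurrence zero    (+ suc (suc (suc n))) =
    trans (ℤₚ.*-zeroʳ (+ suc (suc (suc n)))) (sym (ℤₚ.*-zeroʳ (+ suc (suc (suc n)) - + 2 - 0ℤ)))
  poly-[1-z²]-recurrence zero    -[1+ n ]              = trans (ℤₚ.*-zeroʳ -[1+ n ]) (sym (ℤₚ.*-zeroʳ (-[1+ n ] - + 2 - 0ℤ)))
  poly-[1-z²]-recurrence (suc b) t                     = begin
    t * poly (suc b) (suc b) t                                 ≡⟨ cong (t *_) (poly-diag-suc b t) ⟩
    t * (f t - f (t ⊖ 2))                                      ≡⟨ split t (f t) (f (t ⊖ 2)) ⟩
    t * f t - ((t ⊖ 2) * f (t ⊖ 2) + + 2 * f (t ⊖ 2))          ≡⟨ cong₂ (λ u v → u - (v + + 2 * f (t ⊖ 2)))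
                                                                   (poly-[1-z²]-recurrence b t) (poly-[1-z²]-recurrence b (t ⊖ 2)) ⟩
    (t - + 2 - B) * f (t ⊖ 2) - ((t ⊖ 2 - + 2 - B) * f (t ⊖ 4) + + 2 * f (t ⊖ 2))
                                                               ≡⟨ collect t (+ b) (f (t ⊖ 2)) (f (t ⊖ 4)) ⟩
    (t - + 2 - (+ suc b + + suc b)) * (f (t ⊖ 2) - f (t ⊖ 4))  ≡⟨ cong ((t - + 2 - (+ suc b + + suc b)) *_) (sym (poly-diag-suc b (t ⊖ 2))) ⟩
    (t - + 2 - (+ suc b + + suc b)) * poly (suc b) (suc b) (t ⊖ 2) ∎
    where
    f = poly b b
    B = + b + + b
    split : ∀ t u v → t * (u - v) ≡ t * u - ((t - 1ℤ - 1ℤ) * v + + 2 * v)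
    split = solve-∀
    collect : ∀ t b v w → (t - + 2 - (b + b)) * v - ((t - 1ℤ - 1ℤ - + 2 - (b + b)) * w + + 2 * v)
                          ≡ (t - + 2 - ((1ℤ + b) + (1ℤ + b))) * (v - w)
    collect = solve-∀

  -- Counting subsets by their sum

  #subsets : ∀ {m} → ℕ → F2m m → List (F2m m) → ℕ
  #subsets k s L = count (λ B → (length B ≡ᵇ k) ∧ (sumF B == s)) (sublists L)

  #subsets-∷ : ∀ {m} k (s a : F2m m) L → #subsets (suc k) s (a ∷ L) ≡ #subsets (suc k) s L ℕ.+ #subsets k (a ⊕ s) L
  #subsets-∷ k s a L = trans (count-sublists-∷ _ a L) (cong (#subsets (suc k) s L ℕ.+_)
    (count-cong (sublists L) (λ B → cong ((length B ≡ᵇ k) ∧_) (⊕-==-transpose a (sumF B) s))))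

  #subsets-∷-zero : ∀ {m} (s a : F2m m) L → #subsets 0 s (a ∷ L) ≡ #subsets 0 s L
  #subsets-∷-zero s a L = trans (count-sublists-∷ _ a L) (trans (cong (#subsets 0 s L ℕ.+_) (count-false (sublists L))) (ℕₚ.+-identityʳ _))

  -- ∏_{g ∈ L} (1 + χ_c(g) z)
  charPoly : ∀ {m} → F2m m → List (F2m m) → Seq
  charPoly c L = poly (count (λ g → not (c · g)) L) (count (c ·_) L)

  charPoly-∷ : ∀ {m} (c a : F2m m) L i → charPoly c (a ∷ L) i ≡ charPoly c L i + χ c a * charPoly c L (i - 1ℤ)
  charPoly-∷ c a L i with c · a
  ... | false = cong (_+_ (charPoly c L i)) (sym (ℤₚ.*-identityˡ _))
  ... | true  = trans (poly-suc-right (count (λ g → not (c · g)) L) (count (c ·_) L) i)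
                      (cong (_+_ (charPoly c L i)) (sym (ℤₚ.-1*i≡-i _)))

  charPoly-∷-zero : ∀ {m} (c a : F2m m) L → charPoly c (a ∷ L) (+ 0) ≡ charPoly c L (+ 0)
  charPoly-∷-zero c a L = begin
    charPoly c (a ∷ L) (+ 0)                           ≡⟨ charPoly-∷ c a L (+ 0) ⟩
    charPoly c L (+ 0) + χ c a * charPoly c L -[1+ 0 ] ≡⟨ cong (λ v → charPoly c L (+ 0) + χ c a * v)
                                                            (poly-negative (count (λ g → not (c · g)) L) (count (c ·_) L) 0) ⟩
    charPoly c L (+ 0) + χ c a * 0ℤ                    ≡⟨ cong (_+_ (charPoly c L (+ 0))) (ℤₚ.*-zeroʳ (χ c a)) ⟩
    charPoly c L (+ 0) + 0ℤ                            ≡⟨ ℤₚ.+-identityʳ _ ⟩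
    charPoly c L (+ 0) ∎

  charPoly-without : ∀ {m} (c : F2m m) L s → count (_== s) L ≡ 1 →
    charPoly c (L without s) ≡ poly (count (λ g → not (c · g)) L ∸ 𝟙 (not (c · s))) (count (c ·_) L ∸ 𝟙 (c · s))
  charPoly-without c L s once = cong₂ poly (count-without L s once (λ g → not (c · g))) (count-without L s once (c ·_))

  #subsets-fourier : ∀ m (L : List (F2m m)) k s →
    + (2 ^ m) * + #subsets k s L ≡ ∑ (allElems m) (λ c → χ c s * charPoly c L (+ k))
  #subsets-fourier m []      zero    s with 𝟎 ≟F s
  ... | yes refl = trans (ℤₚ.*-identityʳ _) (sym (trans (∑-cong (allElems m) (λ c → ℤₚ.*-identityʳ (χ c 𝟎))) (∑-χ-at-𝟎 m)))
  ... | no 𝟎≢s   = trans (ℤₚ.*-zeroʳ (+ (2 ^ m))) (sym (trans (∑-cong (allElems m) (λ c → ℤₚ.*-identityʳ (χ c s)))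
                                                                (∑-χ-at m s (λ s≡𝟎 → 𝟎≢s (sym s≡𝟎)))))
  #subsets-fourier m []      (suc k) s = begin
    + (2 ^ m) * 0ℤ                    ≡⟨ ℤₚ.*-zeroʳ (+ (2 ^ m)) ⟩
    0ℤ                                ≡⟨ sym (trans (∑-const (allElems m) 0ℤ) (ℤₚ.*-zeroʳ (+ length (allElems m)))) ⟩
    ∑ (allElems m) (λ _ → 0ℤ)         ≡⟨ ∑-cong (allElems m) (λ c → sym (ℤₚ.*-zeroʳ (χ c s))) ⟩
    ∑ (allElems m) (λ c → χ c s * 0ℤ) ∎
  #subsets-fourier m (a ∷ L) zero    s = begin
    + (2 ^ m) * + #subsets 0 s (a ∷ L)                ≡⟨ cong (λ n → + (2 ^ m) * + n) (#subsets-∷-zero s a L) ⟩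
    + (2 ^ m) * + #subsets 0 s L                      ≡⟨ #subsets-fourier m L 0 s ⟩
    ∑ (allElems m) (λ c → χ c s * charPoly c L (+ 0)) ≡⟨ ∑-cong (allElems m) (λ c → cong (χ c s *_) (sym (charPoly-∷-zero c a L))) ⟩
    ∑ (allElems m) (λ c → χ c s * charPoly c (a ∷ L) (+ 0)) ∎
  #subsets-fourier m (a ∷ L) (suc k) s = begin
    + (2 ^ m) * + #subsets (suc k) s (a ∷ L)
      ≡⟨ cong (λ n → + (2 ^ m) * + n) (#subsets-∷ k s a L) ⟩
    + (2 ^ m) * (+ #subsets (suc k) s L + + #subsets k (a ⊕ s) L)
      ≡⟨ ℤₚ.*-distribˡ-+ (+ (2 ^ m)) (+ #subsets (suc k) s L) _ ⟩
    + (2 ^ m) * + #subsets (suc k) s L + + (2 ^ m) * + #subsets k (a ⊕ s) L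
      ≡⟨ cong₂ _+_ (#subsets-fourier m L (suc k) s) (#subsets-fourier m L k (a ⊕ s)) ⟩
    ∑ (allElems m) (λ c → χ c s * charPoly c L (+ suc k)) + ∑ (allElems m) (λ c → χ c (a ⊕ s) * charPoly c L (+ k))
      ≡⟨ sym (∑-+ (allElems m) _ _) ⟩
    ∑ (allElems m) (λ c → χ c s * charPoly c L (+ suc k) + χ c (a ⊕ s) * charPoly c L (+ k))
      ≡⟨ ∑-cong (allElems m) step ⟩
    ∑ (allElems m) (λ c → χ c s * charPoly c (a ∷ L) (+ suc k)) ∎
    where
    step : ∀ c → χ c s * charPoly c L (+ suc k) + χ c (a ⊕ s) * charPoly c L (+ k) ≡ χ c s * charPoly c (a ∷ L) (+ suc k)
    step c = begin
      χ c s * charPoly c L (+ suc k) + χ c (a ⊕ s) * charPoly c L (+ k)   ≡⟨ cong (λ u → χ c s * charPoly c L (+ suc k) + u * charPoly c L (+ k))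
                                                                                (χ-⊕ c a s) ⟩
      χ c s * charPoly c L (+ suc k) + χ c a * χ c s * charPoly c L (+ k) ≡⟨ factor (χ c s) (χ c a) (charPoly c L (+ suc k)) (charPoly c L (+ k)) ⟩
      χ c s * (charPoly c L (+ suc k) + χ c a * charPoly c L (+ k))       ≡⟨ cong (χ c s *_) (sym (charPoly-∷ c a L (+ suc k))) ⟩
      χ c s * charPoly c (a ∷ L) (+ suc k) ∎
      where factor : ∀ u v p q → u * p + v * u * q ≡ u * (p + v * q)
            factor = solve-∀

  count-sublists-∉ : ∀ {m} (x : F2m m) (P : List (F2m m) → Bool) L →
    count (λ B → P B ∧ not (x ∈ᵇ B)) (sublists L) ≡ count P (sublists (L without x))
  count-sublists-∉ x P []      = cong (λ b → 𝟙 b ℕ.+ 0) (Boolₚ.∧-identityʳ (P []))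
  count-sublists-∉ x P (a ∷ L) with a == x in a==x
  ... | true  = begin
    count Q (sublists (a ∷ L))                                  ≡⟨ count-sublists-∷ Q a L ⟩
    count Q (sublists L) ℕ.+ count (λ B → Q (a ∷ B)) (sublists L) ≡⟨ cong (count Q (sublists L) ℕ.+_)
                                                                       (trans (count-cong (sublists L) a∉) (count-false (sublists L))) ⟩
    count Q (sublists L) ℕ.+ 0                                  ≡⟨ ℕₚ.+-identityʳ _ ⟩
    count Q (sublists L)                                        ≡⟨ count-sublists-∉ x P L ⟩
    count P (sublists (L without x)) ∎
    where
    Q = λ B → P B ∧ not (x ∈ᵇ B)
    a∉ : ∀ B → Q (a ∷ B) ≡ false
    a∉ B rewrite ==-sym x a | a==x = Boolₚ.∧-zeroʳ (P (a ∷ B))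
  ... | false = begin
    count Q (sublists (a ∷ L))
      ≡⟨ count-sublists-∷ Q a L ⟩
    count Q (sublists L) ℕ.+ count (λ B → Q (a ∷ B)) (sublists L)
      ≡⟨ cong₂ ℕ._+_ (count-sublists-∉ x P L)
                     (trans (count-cong (sublists L) a-irrelevant) (count-sublists-∉ x (λ B → P (a ∷ B)) L)) ⟩
    count P (sublists (L without x)) ℕ.+ count (λ B → P (a ∷ B)) (sublists (L without x))
      ≡⟨ sym (count-sublists-∷ P a (L without x)) ⟩
    count P (sublists (a ∷ (L without x))) ∎
    where
    Q = λ B → P B ∧ not (x ∈ᵇ B)
    a-irrelevant : ∀ B → Q (a ∷ B) ≡ P (a ∷ B) ∧ not (x ∈ᵇ B)
    a-irrelevant B rewrite ==-sym x a | a==x = refl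

  -- The closed form of ∑_k λ_k z^k

  -- (1+z)^p (1−z)^q − (the same with one factor 1 + (−1)^e z removed) − (with 1 + (−1)^d z
  -- removed) + (with both removed): the inclusion–exclusion term for a pair of elements.
  pairTerm : ℕ → ℕ → Bool → Bool → Seq
  pairTerm p q e d i =
    poly p q i - poly (p ∸ 𝟙 (not e)) (q ∸ 𝟙 e) i - poly (p ∸ 𝟙 (not d)) (q ∸ 𝟙 d) i
      + poly (p ∸ 𝟙 (not e) ∸ 𝟙 (not d)) (q ∸ 𝟙 e ∸ 𝟙 d) i

  pairTerm-ff : ∀ p q i → pairTerm (2 ℕ.+ p) q false false i ≡ poly p q (i ⊖ 2)
  pairTerm-ff p q = [1+z]-twice (poly p q)

  pairTerm-tt : ∀ p q i → pairTerm p (2 ℕ.+ q) true true i ≡ poly p q (i ⊖ 2)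
  pairTerm-tt p q i = begin
    poly p (2 ℕ.+ q) i - poly p (suc q) i - poly p (suc q) i + poly p q i
      ≡⟨ cong₂ (λ u v → u - v - v + poly p q i)
               (trans (poly-suc-right p (suc q) i) ([1-z]-cong (poly-suc-right p q) i)) (poly-suc-right p q i) ⟩
    [1-z] ([1-z] (poly p q)) i - [1-z] (poly p q) i - [1-z] (poly p q) i + poly p q i
      ≡⟨ [1-z]-twice (poly p q) i ⟩
    poly p q (i ⊖ 2) ∎

  pairTerm-tf : ∀ p q i → pairTerm (suc p) (suc q) true false i ≡ - poly p q (i ⊖ 2)
  pairTerm-tf p q i = begin
    poly (suc p) (suc q) i - poly (suc p) q i - poly p (suc q) i + poly p q i
      ≡⟨ cong₂ (λ u v → u - poly (suc p) q i - v + poly p q i) ([1+z]-cong (poly-suc-right p q) i) (poly-suc-right p q i) ⟩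
    [1+z] ([1-z] (poly p q)) i - [1+z] (poly p q) i - [1-z] (poly p q) i + poly p q i
      ≡⟨ [1+z][1-z]-mixed (poly p q) i ⟩
    - poly p q (i ⊖ 2) ∎

  pairTerm-ft : ∀ p q i → pairTerm (suc p) (suc q) false true i ≡ - poly p q (i ⊖ 2)
  pairTerm-ft p q i = trans (swap (poly (suc p) (suc q) i) (poly p (suc q) i) (poly (suc p) q i) (poly p q i)) (pairTerm-tf p q i)
    where swap : ∀ a b c d → a - b - c + d ≡ a - c - b + d
          swap = solve-∀

  pairTerm-sum : ∀ a i →
    pairTerm (2 ℕ.+ a) (3 ℕ.+ a) true true i + pairTerm (2 ℕ.+ a) (3 ℕ.+ a) true false i
      + pairTerm (2 ℕ.+ a) (3 ℕ.+ a) false true i + pairTerm (2 ℕ.+ a) (3 ℕ.+ a) false false i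
    ≡ + 4 * poly a (suc a) (i ⊖ 4)
  pairTerm-sum a i = begin
    pairTerm (2 ℕ.+ a) (3 ℕ.+ a) true true i + pairTerm (2 ℕ.+ a) (3 ℕ.+ a) true false i
      + pairTerm (2 ℕ.+ a) (3 ℕ.+ a) false true i + pairTerm (2 ℕ.+ a) (3 ℕ.+ a) false false i
      ≡⟨ cong₂ _+_ (cong₂ _+_ (cong₂ _+_ (pairTerm-tt (2 ℕ.+ a) (suc a) i) (pairTerm-tf (suc a) (2 ℕ.+ a) i))
                                        (pairTerm-ft (suc a) (2 ℕ.+ a) i))
                   (pairTerm-ff a (3 ℕ.+ a) i) ⟩
    poly (2 ℕ.+ a) (suc a) j - poly (suc a) (2 ℕ.+ a) j - poly (suc a) (2 ℕ.+ a) j + poly a (3 ℕ.+ a) j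
      ≡⟨ cong₂ (λ u v → [1+z] ([1+z] f) j - u - u + v)
               ([1+z]-cong (poly-suc-right a (suc a)) j)
               (trans (poly-suc-right a (2 ℕ.+ a) j) ([1-z]-cong (poly-suc-right a (suc a)) j)) ⟩
    [1+z] ([1+z] f) j - [1+z] ([1-z] f) j - [1+z] ([1-z] f) j + [1-z] ([1-z] f) j
      ≡⟨ [1±z]-squares f j ⟩
    + 4 * f (j ⊖ 2) ∎
    where
    f = poly a (suc a)
    j = i ⊖ 2

  module _ {m : ℕ} {x y : F2m m} (x≢𝟎 : x ≢ 𝟎) (y≢𝟎 : y ≢ 𝟎) (x≢y : x ≢ y) where

    private
      L₀ Lx Ly Lxy : List (F2m m)
      L₀  = allElems m without 𝟎
      Lx  = L₀ without x
      Ly  = L₀ without y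
      Lxy = Lx without y
      once-x : count (_== x) L₀ ≡ 1
      once-x = trans (count-==-without (allElems m) x≢𝟎) (count-allElems-== m x)
      once-y : count (_== y) L₀ ≡ 1
      once-y = trans (count-==-without (allElems m) y≢𝟎) (count-allElems-== m y)
      once-y-in-Lx : count (_== y) Lx ≡ 1
      once-y-in-Lx = trans (count-==-without L₀ (λ y≡x → x≢y (sym y≡x))) once-y

    lambdaCount-inclusion-exclusion : ∀ k →
      + lambdaCount k x y ≡ + #subsets k 𝟎 L₀ - + #subsets k 𝟎 Lx - + #subsets k 𝟎 Ly + + #subsets k 𝟎 Lxy
    lambdaCount-inclusion-exclusion k = begin
      + lambdaCount k x y
        ≡⟨ cong +_ (trans (cong (λ L → length (filter D (sublists L))) (nonzeroElems≡allElems-without-𝟎 m)) (length-filter D (sublists L₀))) ⟩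
      + count (λ B → (length B ≡ᵇ k) ∧ (sumF B == 𝟎) ∧ (x ∈ᵇ B) ∧ (y ∈ᵇ B)) (sublists L₀)
        ≡⟨ cong +_ (count-cong (sublists L₀) (λ B → sym (Boolₚ.∧-assoc (length B ≡ᵇ k) (sumF B == 𝟎) _))) ⟩
      + count (λ B → P B ∧ (x ∈ᵇ B) ∧ (y ∈ᵇ B)) (sublists L₀)
        ≡⟨ count-inclusion-exclusion P (x ∈ᵇ_) (y ∈ᵇ_) (sublists L₀) ⟩
      + count P (sublists L₀) - + count (λ B → P B ∧ not (x ∈ᵇ B)) (sublists L₀)
        - + count (λ B → P B ∧ not (y ∈ᵇ B)) (sublists L₀) + + count (λ B → P B ∧ not (x ∈ᵇ B) ∧ not (y ∈ᵇ B)) (sublists L₀)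
        ≡⟨ alternating-cong (refl {x = + count P (sublists L₀)}) (cong +_ (count-sublists-∉ x P L₀)) (cong +_ (count-sublists-∉ y P L₀)) (cong +_ (begin
             count (λ B → P B ∧ not (x ∈ᵇ B) ∧ not (y ∈ᵇ B)) (sublists L₀)
               ≡⟨ count-cong (sublists L₀) (λ B → reorder (P B) (x ∈ᵇ B) (y ∈ᵇ B)) ⟩
             count (λ B → (P B ∧ not (y ∈ᵇ B)) ∧ not (x ∈ᵇ B)) (sublists L₀)
               ≡⟨ count-sublists-∉ x (λ B → P B ∧ not (y ∈ᵇ B)) L₀ ⟩
             count (λ B → P B ∧ not (y ∈ᵇ B)) (sublists Lx)
               ≡⟨ count-sublists-∉ y P Lx ⟩
             count P (sublists Lxy) ∎)) ⟩
      + #subsets k 𝟎 L₀ - + #subsets k 𝟎 Lx - + #subsets k 𝟎 Ly + + #subsets k 𝟎 Lxy ∎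
      where
      open import Data.List.Membership.DecPropositional (_≟F_ {m}) using (_∈?_)
      D = λ B → (length B ℕ.≟ k) ×-dec ((sumF B ≟F 𝟎) ×-dec ((x ∈? B) ×-dec (y ∈? B)))
      P = λ B → (length B ≡ᵇ k) ∧ (sumF B == 𝟎)
      reorder : ∀ p u v → p ∧ not u ∧ not v ≡ (p ∧ not v) ∧ not u
      reorder p true  v = trans (Boolₚ.∧-zeroʳ p) (sym (Boolₚ.∧-zeroʳ (p ∧ not v)))
      reorder p false v = sym (Boolₚ.∧-identityʳ _)

    lambdaCount-fourier : ∀ k → + (2 ^ m) * + lambdaCount k x y ≡
      ∑ (allElems m) (λ c → pairTerm (count (λ g → not (c · g)) L₀) (count (c ·_) L₀) (c · x) (c · y) (+ k))
    lambdaCount-fourier k = begin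
      + (2 ^ m) * + lambdaCount k x y
        ≡⟨ cong (+ (2 ^ m) *_) (lambdaCount-inclusion-exclusion k) ⟩
      + (2 ^ m) * (+ #subsets k 𝟎 L₀ - + #subsets k 𝟎 Lx - + #subsets k 𝟎 Ly + + #subsets k 𝟎 Lxy)
        ≡⟨ distrib (+ (2 ^ m)) (+ #subsets k 𝟎 L₀) (+ #subsets k 𝟎 Lx) (+ #subsets k 𝟎 Ly) (+ #subsets k 𝟎 Lxy) ⟩
      N#[ L₀ ] - N#[ Lx ] - N#[ Ly ] + N#[ Lxy ]
        ≡⟨ alternating-cong (fourier L₀) (fourier Lx) (fourier Ly) (fourier Lxy) ⟩
      ∑ all (charPolyAt L₀) - ∑ all (charPolyAt Lx) - ∑ all (charPolyAt Ly) + ∑ all (charPolyAt Lxy)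
        ≡⟨ sym (trans (∑-+ all _ (charPolyAt Lxy)) (cong (_+ ∑ all (charPolyAt Lxy))
                 (trans (∑-sub all _ (charPolyAt Ly)) (cong (_- ∑ all (charPolyAt Ly)) (∑-sub all (charPolyAt L₀) (charPolyAt Lx)))))) ⟩
      ∑ all (λ c → charPolyAt L₀ c - charPolyAt Lx c - charPolyAt Ly c + charPolyAt Lxy c)
        ≡⟨ ∑-cong all (λ c → alternating-cong (refl {x = charPolyAt L₀ c}) (without-x c) (without-y c) (without-xy c)) ⟩
      ∑ all (λ c → pairTerm (count (λ g → not (c · g)) L₀) (count (c ·_) L₀) (c · x) (c · y) (+ k)) ∎
      where
      all = allElems m
      N#[_] : List (F2m m) → ℤ
      N#[ L ] = + (2 ^ m) * + #subsets k 𝟎 L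
      charPolyAt : List (F2m m) → F2m m → ℤ
      charPolyAt L c = charPoly c L (+ k)
      distrib : ∀ n a b c d → n * (a - b - c + d) ≡ n * a - n * b - n * c + n * d
      distrib = solve-∀
      fourier : ∀ L → N#[ L ] ≡ ∑ all (charPolyAt L)
      fourier L = trans (#subsets-fourier m L k 𝟎)
        (∑-cong all (λ c → trans (cong (λ b → sgn b * charPolyAt L c) (·-zeroʳ c)) (ℤₚ.*-identityˡ _)))
      without-x = λ c → cong-app (charPoly-without c L₀ x once-x) (+ k)
      without-y = λ c → cong-app (charPoly-without c L₀ y once-y) (+ k)
      without-xy = λ c → trans (cong-app (charPoly-without c Lx y once-y-in-Lx) (+ k))
        (cong₂ (λ p q → poly (p ∸ 𝟙 (not (c · y))) (q ∸ 𝟙 (c · y)) (+ k))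
               (count-without L₀ x once-x (λ g → not (c · g))) (count-without L₀ x once-x (c ·_)))

  -- N · ∑_k λ_k z^k, where N = 2^m = 2a + 6
  lambdaSeq : ℕ → Seq
  lambdaSeq a j = + (6 ℕ.+ (a ℕ.+ a)) * poly a (suc a) (j ⊖ 4) + (poly (3 ℕ.+ (a ℕ.+ a)) 0 (j ⊖ 2) - poly a (3 ℕ.+ a) (j ⊖ 2))

  2^[1+M]≡6+2a : ∀ M {a} → 2 ^ M ≡ 3 ℕ.+ a → 2 ^ suc M ≡ 6 ℕ.+ (a ℕ.+ a)
  2^[1+M]≡6+2a M {a} 2^M≡3+a = trans (cong (λ n → n ℕ.+ (n ℕ.+ 0)) 2^M≡3+a) (double a)
    where double : ∀ a → 3 ℕ.+ a ℕ.+ (3 ℕ.+ a ℕ.+ 0) ≡ 6 ℕ.+ (a ℕ.+ a)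
          double = ℕ-Solver.solve-∀

  lambdaCount-formula : ∀ M a → 2 ^ M ≡ 3 ℕ.+ a → {x y : F2m (suc M)} → x ≢ 𝟎 → y ≢ 𝟎 → x ≢ y →
    ∀ k → + (6 ℕ.+ (a ℕ.+ a)) * + lambdaCount k x y ≡ lambdaSeq a (+ k)
  lambdaCount-formula M a 2^M≡3+a {x} {y} x≢𝟎 y≢𝟎 x≢y k = begin
    + (6 ℕ.+ (a ℕ.+ a)) * + lambdaCount k x y ≡⟨ cong (λ n → + n * + lambdaCount k x y) (sym 2^m≡6+2a) ⟩
    + (2 ^ suc M) * + lambdaCount k x y       ≡⟨ lambdaCount-fourier x≢𝟎 y≢𝟎 x≢y k ⟩
    ∑ all f                                   ≡⟨ ∑-allElems-update (suc M) f g f≡g ⟩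
    ∑ all g + (f 𝟎 - g 𝟎)                     ≡⟨ cong₂ _+_ ∑g (cong₂ _-_ (trans f𝟎 (pairTerm-ff (3 ℕ.+ (a ℕ.+ a)) 0 (+ k)))
                                                                       (trans g𝟎 (pairTerm-ff a (3 ℕ.+ a) (+ k)))) ⟩
    lambdaSeq a (+ k) ∎
    where
    2^m≡6+2a = 2^[1+M]≡6+2a M 2^M≡3+a
    all = allElems (suc M)
    L₀ = all without 𝟎
    f g : F2m (suc M) → ℤ
    f c = pairTerm (count (λ z → not (c · z)) L₀) (count (c ·_) L₀) (c · x) (c · y) (+ k)
    g c = pairTerm (2 ℕ.+ a) (3 ℕ.+ a) (c · x) (c · y) (+ k)
    f≡g : ∀ c → c ≢ 𝟎 → f c ≡ g c
    f≡g c c≢𝟎 with count-·-without-𝟎 M c c≢𝟎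
    ... | plus≡ , minus≡ = cong₂ (λ p q → pairTerm p q (c · x) (c · y) (+ k))
                                 (trans plus≡ (cong (_∸ 1) 2^M≡3+a)) (trans minus≡ 2^M≡3+a)
    f𝟎 : f 𝟎 ≡ pairTerm (5 ℕ.+ (a ℕ.+ a)) 0 false false (+ k)
    f𝟎 with count-𝟎·-without-𝟎 (suc M)
    ... | plus≡ , minus≡ = cong₂ (λ pq ed → pairTerm (proj₁ pq) (proj₂ pq) (proj₁ ed) (proj₂ ed) (+ k))
                                 (cong₂ _,_ (trans plus≡ (cong (_∸ 1) 2^m≡6+2a)) minus≡)
                                 (cong₂ _,_ (·-zeroˡ x) (·-zeroˡ y))
    g𝟎 : g 𝟎 ≡ pairTerm (2 ℕ.+ a) (3 ℕ.+ a) false false (+ k)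
    g𝟎 = cong₂ (λ e d → pairTerm (2 ℕ.+ a) (3 ℕ.+ a) e d (+ k)) (·-zeroˡ x) (·-zeroˡ y)
    φ : Bool → Bool → ℤ
    φ e d = pairTerm (2 ℕ.+ a) (3 ℕ.+ a) e d (+ k)
    ∑g : ∑ all g ≡ + (6 ℕ.+ (a ℕ.+ a)) * poly a (suc a) (+ k ⊖ 4)
    ∑g = ℤₚ.*-cancelˡ-≡ (+ 4) _ _ (begin
      + 4 * ∑ all g                                                               ≡⟨ ∑-character-pair (suc M) x≢𝟎 y≢𝟎 x≢y φ ⟩
      + (2 ^ suc M) * (φ true true + φ true false + φ false true + φ false false) ≡⟨ cong (+ (2 ^ suc M) *_) (pairTerm-sum a (+ k)) ⟩
      + (2 ^ suc M) * (+ 4 * poly a (suc a) (+ k ⊖ 4))                           ≡⟨ cong (λ n → + n * (+ 4 * poly a (suc a) (+ k ⊖ 4))) 2^m≡6+2a ⟩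
      + (6 ℕ.+ (a ℕ.+ a)) * (+ 4 * poly a (suc a) (+ k ⊖ 4))                     ≡⟨ swap (+ (6 ℕ.+ (a ℕ.+ a))) (poly a (suc a) (+ k ⊖ 4)) ⟩
      + 4 * (+ (6 ℕ.+ (a ℕ.+ a)) * poly a (suc a) (+ k ⊖ 4)) ∎)
      where swap : ∀ n p → n * (+ 4 * p) ≡ + 4 * (n * p)
            swap = solve-∀

  -- The recurrence

  combine₄ : ∀ {x y d₁ d₂ d₃ d₄ : ℤ} c₁ c₂ c₃ c₄ → x - y ≡ c₁ * d₁ + c₂ * d₂ + c₃ * d₃ + c₄ * d₄ →
    d₁ ≡ 0ℤ → d₂ ≡ 0ℤ → d₃ ≡ 0ℤ → d₄ ≡ 0ℤ → x ≡ y
  combine₄ {x} {y} c₁ c₂ c₃ c₄ x-y≡ refl refl refl refl =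
    ℤₚ.i-j≡0⇒i≡j x y (trans x-y≡ (zeros c₁ c₂ c₃ c₄))
    where zeros : ∀ c₁ c₂ c₃ c₄ → c₁ * 0ℤ + c₂ * 0ℤ + c₃ * 0ℤ + c₄ * 0ℤ ≡ 0ℤ
          zeros = solve-∀

  -- With r_s = R (j − s) for R = (1−z²)^a and e_s = E (j − s) for E = (1+z)^{2a+3}, the
  -- hypotheses are the coefficient recurrences of R and E and the conclusion is that of
  -- N ∑ λ_k z^k; it is the combination −h₁ − (N−2) h₂ + (N−1) h₃ + h₄, N = 2a + 6.
  recurrence-algebra : ∀ j A r₂ r₃ r₄ r₅ r₆ e₂ e₃ →
    (j - 1ℤ - 1ℤ) * r₂ ≡ (j - 1ℤ - 1ℤ - + 2 - (A + A)) * r₄ →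
    (j - 1ℤ - 1ℤ - 1ℤ) * r₃ ≡ (j - 1ℤ - 1ℤ - 1ℤ - + 2 - (A + A)) * r₅ →
    (j - 1ℤ - 1ℤ - 1ℤ - 1ℤ) * r₄ ≡ (j - 1ℤ - 1ℤ - 1ℤ - 1ℤ - + 2 - (A + A)) * r₆ →
    (j - 1ℤ - 1ℤ) * e₂ ≡ (+ 4 + (A + A) - (j - 1ℤ - 1ℤ)) * e₃ →
    (j - 1ℤ - 1ℤ) * ((+ 6 + (A + A)) * (r₄ - r₅) + (e₂ - ((r₂ - r₃) - (r₃ - r₄) - ((r₃ - r₄) - (r₄ - r₅)))))
      ≡ (+ 6 + (A + A) - j) * ((+ 6 + (A + A)) * (r₅ - r₆) + (e₃ - ((r₃ - r₄) - (r₄ - r₅) - ((r₄ - r₅) - (r₅ - r₆)))))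
        + (+ 6 + (A + A)) * (j - 1ℤ - 1ℤ) * (r₃ - r₅)
  recurrence-algebra j A r₂ r₃ r₄ r₅ r₆ e₂ e₃ h₁ h₂ h₃ h₄ =
    combine₄ -1ℤ (- (+ 4 + (A + A))) (+ 5 + (A + A)) 1ℤ (identity j A r₂ r₃ r₄ r₅ r₆ e₂ e₃)
      (ℤₚ.i≡j⇒i-j≡0 h₁) (ℤₚ.i≡j⇒i-j≡0 h₂) (ℤₚ.i≡j⇒i-j≡0 h₃) (ℤₚ.i≡j⇒i-j≡0 h₄)
    where
    identity : ∀ j A r₂ r₃ r₄ r₅ r₆ e₂ e₃ →
      (j - 1ℤ - 1ℤ) * ((+ 6 + (A + A)) * (r₄ - r₅) + (e₂ - ((r₂ - r₃) - (r₃ - r₄) - ((r₃ - r₄) - (r₄ - r₅)))))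
      - ((+ 6 + (A + A) - j) * ((+ 6 + (A + A)) * (r₅ - r₆) + (e₃ - ((r₃ - r₄) - (r₄ - r₅) - ((r₄ - r₅) - (r₅ - r₆)))))
         + (+ 6 + (A + A)) * (j - 1ℤ - 1ℤ) * (r₃ - r₅))
      ≡ -1ℤ * ((j - 1ℤ - 1ℤ) * r₂ - (j - 1ℤ - 1ℤ - + 2 - (A + A)) * r₄)
        + - (+ 4 + (A + A)) * ((j - 1ℤ - 1ℤ - 1ℤ) * r₃ - (j - 1ℤ - 1ℤ - 1ℤ - + 2 - (A + A)) * r₅)
        + (+ 5 + (A + A)) * ((j - 1ℤ - 1ℤ - 1ℤ - 1ℤ) * r₄ - (j - 1ℤ - 1ℤ - 1ℤ - 1ℤ - + 2 - (A + A)) * r₆)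
        + 1ℤ * ((j - 1ℤ - 1ℤ) * e₂ - (+ 4 + (A + A) - (j - 1ℤ - 1ℤ)) * e₃)
    identity = solve-∀

  lambdaSeq-recurrence : ∀ a j → (j ⊖ 2) * lambdaSeq a j
    ≡ (+ (6 ℕ.+ (a ℕ.+ a)) - j) * lambdaSeq a (j - 1ℤ) + + (6 ℕ.+ (a ℕ.+ a)) * (j ⊖ 2) * poly (suc a) (suc a) (j ⊖ 3)
  lambdaSeq-recurrence a j = begin
    (j ⊖ 2) * lambdaSeq a j
      ≡⟨ cong ((j ⊖ 2) *_) (expand j) ⟩
    (j ⊖ 2) * (N * (R (j ⊖ 4) - R (j ⊖ 5)) + (E (j ⊖ 2) - [1-z] ([1-z] ([1-z] R)) (j ⊖ 2)))
      ≡⟨ recurrence-algebra j (+ a) (R (j ⊖ 2)) (R (j ⊖ 3)) (R (j ⊖ 4)) (R (j ⊖ 5)) (R (j ⊖ 6)) (E (j ⊖ 2)) (E (j ⊖ 3))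
           (poly-[1-z²]-recurrence a (j ⊖ 2)) (poly-[1-z²]-recurrence a (j ⊖ 3)) (poly-[1-z²]-recurrence a (j ⊖ 4))
           (poly-[1+z]-recurrence (3 ℕ.+ (a ℕ.+ a)) (j ⊖ 2)) ⟩
    (N - j) * (N * (R (j ⊖ 5) - R (j ⊖ 6)) + (E (j ⊖ 3) - [1-z] ([1-z] ([1-z] R)) (j ⊖ 3))) + N * (j ⊖ 2) * (R (j ⊖ 3) - R (j ⊖ 5))
      ≡⟨ sym (cong₂ (λ u v → (N - j) * u + N * (j ⊖ 2) * v) (expand (j - 1ℤ)) (poly-diag-suc a (j ⊖ 3))) ⟩
    (N - j) * lambdaSeq a (j - 1ℤ) + N * (j ⊖ 2) * poly (suc a) (suc a) (j ⊖ 3) ∎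
    where
    N = + (6 ℕ.+ (a ℕ.+ a))
    R = poly a a
    E = poly (3 ℕ.+ (a ℕ.+ a)) 0
    expand : ∀ i → lambdaSeq a i ≡ N * (R (i ⊖ 4) - R (i ⊖ 5)) + (E (i ⊖ 2) - [1-z] ([1-z] ([1-z] R)) (i ⊖ 2))
    expand i = cong₂ (λ u v → N * u + (E (i ⊖ 2) - v)) (poly-suc-right a a (i ⊖ 4))
      (trans (poly-suc-right a (2 ℕ.+ a) (i ⊖ 2))
             ([1-z]-cong (λ l → trans (poly-suc-right a (suc a) l) ([1-z]-cong (poly-suc-right a a) l)) (i ⊖ 2)))

  module LambdaRecurrence (M u : ℕ) (2^M≡3+a : 2 ^ M ≡ 3 ℕ.+ suc (u ℕ.+ u))
                          {x y : F2m (suc M)} (x≢𝟎 : x ≢ 𝟎) (y≢𝟎 : y ≢ 𝟎) (x≢y : x ≢ y) where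

    a N : ℕ
    a = suc (u ℕ.+ u)
    N = 6 ℕ.+ (a ℕ.+ a)

    λ[_] : ℕ → ℤ
    λ[ k ] = + lambdaCount k x y

    2^m≡N : 2 ^ suc M ≡ N
    2^m≡N = 2^[1+M]≡6+2a M 2^M≡3+a

    T : Seq
    T = poly (suc a) (suc a)

    N*λ≡lambdaSeq : ∀ k → + N * λ[ k ] ≡ lambdaSeq a (+ k)
    N*λ≡lambdaSeq = lambdaCount-formula M a 2^M≡3+a x≢𝟎 y≢𝟎 x≢y

    λ-recurrence : ∀ k → (+ suc k ⊖ 2) * λ[ suc k ] ≡ (+ N - + suc k) * λ[ k ] + (+ suc k ⊖ 2) * T (+ suc k ⊖ 3)
    λ-recurrence k = ℤₚ.*-cancelˡ-≡ (+ N) _ _ (begin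
      + N * ((j ⊖ 2) * λ[ suc k ])                              ≡⟨ swap (+ N) (j ⊖ 2) λ[ suc k ] ⟩
      (j ⊖ 2) * (+ N * λ[ suc k ])                              ≡⟨ cong ((j ⊖ 2) *_) (N*λ≡lambdaSeq (suc k)) ⟩
      (j ⊖ 2) * lambdaSeq a j                                   ≡⟨ lambdaSeq-recurrence a j ⟩
      (+ N - j) * lambdaSeq a (+ k) + + N * (j ⊖ 2) * T (j ⊖ 3) ≡⟨ cong (λ v → (+ N - j) * v + + N * (j ⊖ 2) * T (j ⊖ 3)) (sym (N*λ≡lambdaSeq k)) ⟩
      (+ N - j) * (+ N * λ[ k ]) + + N * (j ⊖ 2) * T (j ⊖ 3)    ≡⟨ factor (+ N) (+ N - j) λ[ k ] (j ⊖ 2) (T (j ⊖ 3)) ⟩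
      + N * ((+ N - j) * λ[ k ] + (j ⊖ 2) * T (j ⊖ 3)) ∎)
      where
      j = + suc k
      swap : ∀ n c l → n * (c * l) ≡ c * (n * l)
      swap = solve-∀
      factor : ∀ n c l d t → c * (n * l) + n * d * t ≡ n * (c * l + d * t)
      factor = solve-∀

    -1^a : -1ℤ ℤ.^ a ≡ -1ℤ
    -1^a = cong (-1ℤ *_) (-1^-double u)

    λ[N-1]≡1 : λ[ 5 ℕ.+ (a ℕ.+ a) ] ≡ 1ℤ
    λ[N-1]≡1 = ℤₚ.*-cancelˡ-≡ (+ N) _ _ (begin
      + N * λ[ 5 ℕ.+ (a ℕ.+ a) ]
        ≡⟨ N*λ≡lambdaSeq (5 ℕ.+ (a ℕ.+ a)) ⟩
      + N * poly a (suc a) (+ suc (a ℕ.+ a)) + (poly (3 ℕ.+ (a ℕ.+ a)) 0 (+ (3 ℕ.+ (a ℕ.+ a))) - poly a (3 ℕ.+ a) (+ (3 ℕ.+ (a ℕ.+ a))))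
        ≡⟨ cong₂ (λ s t → + N * s + t) (top a (suc a) (ℕₚ.+-suc a a))
                 (cong₂ _-_ (top (3 ℕ.+ (a ℕ.+ a)) 0 (ℕₚ.+-identityʳ _)) (top a (3 ℕ.+ a) (a+[3+a]≡3+2a a))) ⟩
      + N * (-1ℤ * -1ℤ ℤ.^ a) + (1ℤ - -1ℤ * (-1ℤ * (-1ℤ * -1ℤ ℤ.^ a)))
        ≡⟨ cong (λ s → + N * (-1ℤ * s) + (1ℤ - -1ℤ * (-1ℤ * (-1ℤ * s)))) -1^a ⟩
      + N * 1ℤ + (1ℤ - 1ℤ)
        ≡⟨ ℤₚ.+-identityʳ (+ N * 1ℤ) ⟩
      + N * 1ℤ ∎)
      where
      top : ∀ p q {n} → p ℕ.+ q ≡ n → poly p q (+ n) ≡ -1ℤ ℤ.^ q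
      top p q refl = poly-top p q
      a+[3+a]≡3+2a : ∀ a → a ℕ.+ (3 ℕ.+ a) ≡ 3 ℕ.+ (a ℕ.+ a)
      a+[3+a]≡3+2a = ℕ-Solver.solve-∀

    λ[N-2]≡0 : λ[ 4 ℕ.+ (a ℕ.+ a) ] ≡ 0ℤ
    λ[N-2]≡0 = isolate {λ[ 4 ℕ.+ (a ℕ.+ a) ]} (begin
      c * 1ℤ                                                   ≡⟨ cong (c *_) (sym λ[N-1]≡1) ⟩
      c * λ[ 5 ℕ.+ (a ℕ.+ a) ]                                 ≡⟨ λ-recurrence (4 ℕ.+ (a ℕ.+ a)) ⟩
      (+ N - + (5 ℕ.+ (a ℕ.+ a))) * λ[ 4 ℕ.+ (a ℕ.+ a) ] + c * T (+ (2 ℕ.+ (a ℕ.+ a)))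
                                                               ≡⟨ cong₂ (λ d t → d * λ[ 4 ℕ.+ (a ℕ.+ a) ] + c * t) (N-[N-1]≡1 (+ (a ℕ.+ a))) T-top ⟩
      1ℤ * λ[ 4 ℕ.+ (a ℕ.+ a) ] + c * 1ℤ ∎)
      where
      c = + (3 ℕ.+ (a ℕ.+ a))
      N-[N-1]≡1 : ∀ n → + 6 + n - (+ 5 + n) ≡ 1ℤ
      N-[N-1]≡1 = solve-∀
      T-top : T (+ (2 ℕ.+ (a ℕ.+ a))) ≡ 1ℤ
      T-top = trans (cong (λ n → T (+ suc n)) (sym (ℕₚ.+-suc a a))) (trans (poly-top (suc a) (suc a)) (cong (-1ℤ *_) -1^a))
      isolate : ∀ {l} → c * 1ℤ ≡ 1ℤ * l + c * 1ℤ → l ≡ 0ℤ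
      isolate {l} e = sym (trans (sym (ℤₚ.+-inverseʳ (c * 1ℤ))) (trans (cong (_- c * 1ℤ) e) (cancel l c)))
        where cancel : ∀ l c → 1ℤ * l + c * 1ℤ - c * 1ℤ ≡ l
              cancel = solve-∀

    λ[N-3]≡0 : λ[ 3 ℕ.+ (a ℕ.+ a) ] ≡ 0ℤ
    λ[N-3]≡0 = ℤₚ.*-cancelˡ-≡ (+ 2) _ _ (isolate {λ[ 3 ℕ.+ (a ℕ.+ a) ]} (begin
      c * 0ℤ                                                   ≡⟨ cong (c *_) (sym λ[N-2]≡0) ⟩
      c * λ[ 4 ℕ.+ (a ℕ.+ a) ]                                 ≡⟨ λ-recurrence (3 ℕ.+ (a ℕ.+ a)) ⟩
      (+ N - + (4 ℕ.+ (a ℕ.+ a))) * λ[ 3 ℕ.+ (a ℕ.+ a) ] + c * T (+ suc (a ℕ.+ a))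
                                                               ≡⟨ cong₂ (λ d t → d * λ[ 3 ℕ.+ (a ℕ.+ a) ] + c * t) (N-[N-2]≡2 (+ (a ℕ.+ a))) (poly-diag-odd (suc a) a) ⟩
      + 2 * λ[ 3 ℕ.+ (a ℕ.+ a) ] + c * 0ℤ ∎))
      where
      c = + (2 ℕ.+ (a ℕ.+ a))
      N-[N-2]≡2 : ∀ n → + 6 + n - (+ 4 + n) ≡ + 2
      N-[N-2]≡2 = solve-∀
      isolate : ∀ {l} → c * 0ℤ ≡ + 2 * l + c * 0ℤ → + 2 * l ≡ + 2 * 0ℤ
      isolate {l} e = trans (cancel l c) (trans (cong (_- c * 0ℤ) (sym e)) (ℤₚ.+-inverseʳ (c * 0ℤ)))
        where cancel : ∀ l c → + 2 * l ≡ + 2 * l + c * 0ℤ - c * 0ℤ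
              cancel = solve-∀

    -- λ_{N−1} = 1 (from the closed form), and the recurrence then forces λ_{N−2} = λ_{N−3} = 0;
    -- so the convention λ'_{N−3} = 0 agrees with λ'_k = 2^{k−3} λ_k.
    lambda'≡ : ∀ k → lambda' (suc M) k x y ≡ + (2 ^ (k ∸ 3) ℕ.* lambdaCount k x y)
    lambda'≡ k with k ℕ.≟ (2 ^ suc M ∸ 3)
    ... | no  _    = refl
    ... | yes refl = cong +_ (sym (trans (cong (2 ^ (k ∸ 3) ℕ.*_) λ≡0) (ℕₚ.*-zeroʳ (2 ^ (k ∸ 3)))))
      where
      λ≡0 : lambdaCount (2 ^ suc M ∸ 3) x y ≡ 0
      λ≡0 = ℤₚ.+-injective (trans (cong λ[_] (cong (_∸ 3) 2^m≡N)) λ[N-3]≡0)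

    lambda'-recurrence : ∀ k → 3 ≤ k → k ≤ 2 ^ suc M ∸ 4 →
      + (k ∸ 1) * lambda' (suc M) (suc k) x y
        ≡ + (2 ^ (suc M ℕ.+ 1) ∸ 2 ℕ.* k ∸ 2) * lambda' (suc M) k x y + + (k ∸ 1) * (+ (2 ^ (k ∸ 2)) * T (+ (k ∸ 2)))
    lambda'-recurrence k@(suc (suc (suc k'))) (s≤s (s≤s (s≤s _))) k≤N-4
      with r , k+r≡N-4 ← ℕₚ.m≤n⇒∃[o]m+o≡n (subst (k ≤_) (cong (_∸ 4) 2^m≡N) k≤N-4) = begin
      + (2 ℕ.+ k') * lambda' (suc M) (suc k) x y
        ≡⟨ cong (+ (2 ℕ.+ k') *_) (trans (lambda'≡ (suc k)) (scale (2 ^ k') (lambdaCount (suc k) x y))) ⟩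
      + (2 ℕ.+ k') * (+ 2 * P * λ[ suc k ])
        ≡⟨ rescale (+ k') (+ r) P λ[ suc k ] λ[ k ] (T (+ (k ∸ 2)))
             (trans (λ-recurrence k) (cong (λ d → d * λ[ k ] + + (2 ℕ.+ k') * T (+ (k ∸ 2))) N-[k+1]≡3+r)) ⟩
      + (6 ℕ.+ (r ℕ.+ r)) * (P * λ[ k ]) + + (2 ℕ.+ k') * (+ 2 * P * T (+ (k ∸ 2)))
        ≡⟨ sym (cong₂ (λ c l → c * l + + (2 ℕ.+ k') * (+ 2 * P * T (+ (k ∸ 2))))
                      (cong +_ 2^[m+1]∸2k∸2≡6+2r) (trans (lambda'≡ k) (ℤₚ.pos-* (2 ^ k') _))) ⟩
      + (2 ^ (suc M ℕ.+ 1) ∸ 2 ℕ.* k ∸ 2) * lambda' (suc M) k x y + + (2 ℕ.+ k') * (+ 2 * P * T (+ (k ∸ 2)))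
        ≡⟨ cong (λ p → + (2 ^ (suc M ℕ.+ 1) ∸ 2 ℕ.* k ∸ 2) * lambda' (suc M) k x y + + (2 ℕ.+ k') * (p * T (+ (k ∸ 2))))
                (sym (ℤₚ.pos-* 2 (2 ^ k'))) ⟩
      + (2 ^ (suc M ℕ.+ 1) ∸ 2 ℕ.* k ∸ 2) * lambda' (suc M) k x y + + (2 ℕ.+ k') * (+ (2 ^ (k ∸ 2)) * T (+ (k ∸ 2))) ∎
      where
      P = + (2 ^ k')
      scale : ∀ p l → + (2 ℕ.* p ℕ.* l) ≡ + 2 * + p * + l
      scale p l = trans (ℤₚ.pos-* (2 ℕ.* p) l) (cong (_* + l) (ℤₚ.pos-* 2 p))
      N≡ : N ≡ 4 ℕ.+ (k ℕ.+ r)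
      N≡ = cong (4 ℕ.+_) (sym k+r≡N-4)
      N-[k+1]≡3+r : + N - + (4 ℕ.+ k') ≡ + 3 + + r
      N-[k+1]≡3+r = trans (cong (λ n → + n - + (4 ℕ.+ k')) N≡) (cancel (+ k') (+ r))
        where cancel : ∀ K R → + 4 + (+ 3 + K + R) - (+ 4 + K) ≡ + 3 + R
              cancel = solve-∀
      2^[m+1]∸2k∸2≡6+2r : 2 ^ (suc M ℕ.+ 1) ∸ 2 ℕ.* k ∸ 2 ≡ 6 ℕ.+ (r ℕ.+ r)
      2^[m+1]∸2k∸2≡6+2r = cong (_∸ 2) (begin
        2 ^ (suc M ℕ.+ 1) ∸ 2 ℕ.* k             ≡⟨ cong (λ n → 2 ^ n ∸ 2 ℕ.* k) (ℕₚ.+-comm (suc M) 1) ⟩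
        2 ℕ.* 2 ^ suc M ∸ 2 ℕ.* k               ≡⟨ cong (λ n → 2 ℕ.* n ∸ 2 ℕ.* k) (trans 2^m≡N N≡) ⟩
        2 ℕ.* (4 ℕ.+ (k ℕ.+ r)) ∸ 2 ℕ.* k       ≡⟨ cong (_∸ 2 ℕ.* k) (double k r) ⟩
        2 ℕ.* k ℕ.+ (8 ℕ.+ (r ℕ.+ r)) ∸ 2 ℕ.* k ≡⟨ ℕₚ.m+n∸m≡n (2 ℕ.* k) _ ⟩
        8 ℕ.+ (r ℕ.+ r) ∎)
        where double : ∀ k r → 2 ℕ.* (4 ℕ.+ (k ℕ.+ r)) ≡ 2 ℕ.* k ℕ.+ (8 ℕ.+ (r ℕ.+ r))
              double = ℕ-Solver.solve-∀
      rescale : ∀ K R P l₊ l t → (+ 2 + K) * l₊ ≡ (+ 3 + R) * l + (+ 2 + K) * t →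
                (+ 2 + K) * (+ 2 * P * l₊) ≡ (+ 6 + (R + R)) * (P * l) + (+ 2 + K) * (+ 2 * P * t)
      rescale K R P l₊ l t e = begin
        (+ 2 + K) * (+ 2 * P * l₊)                           ≡⟨ regroup K P l₊ ⟩
        + 2 * P * ((+ 2 + K) * l₊)                           ≡⟨ cong (+ 2 * P *_) e ⟩
        + 2 * P * ((+ 3 + R) * l + (+ 2 + K) * t)            ≡⟨ distribute K R P l t ⟩
        (+ 6 + (R + R)) * (P * l) + (+ 2 + K) * (+ 2 * P * t) ∎
        where
        regroup : ∀ K P l₊ → (+ 2 + K) * (+ 2 * P * l₊) ≡ + 2 * P * ((+ 2 + K) * l₊)
        regroup = solve-∀
        distribute : ∀ K R P l t → + 2 * P * ((+ 3 + R) * l + (+ 2 + K) * t) ≡ (+ 6 + (R + R)) * (P * l) + (+ 2 + K) * (+ 2 * P * t)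
        distribute = solve-∀

    module _ (k : ℕ) (3≤k : 3 ≤ k) (k≤2^m∸4 : k ≤ 2 ^ suc M ∸ 4) where

      private
        base binomial : ℤ
        base     = + (2 ^ (suc M ℕ.+ 1) ∸ 2 ℕ.* k ∸ 2) * lambda' (suc M) k x y
        binomial = + (2 ^ (k ∸ 2) ℕ.* ((2 ^ M ∸ 2) C (k / 2 ∸ 1)))

        recurrence-with : ∀ {t} → T (+ (k ∸ 2)) ≡ t →
          + (k ∸ 1) * lambda' (suc M) (suc k) x y ≡ base + + (k ∸ 1) * (+ (2 ^ (k ∸ 2)) * t)
        recurrence-with T≡t = trans (lambda'-recurrence k 3≤k k≤2^m∸4) (cong (λ t → base + + (k ∸ 1) * (+ (2 ^ (k ∸ 2)) * t)) T≡t)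

        recurrence-vanishing : T (+ (k ∸ 2)) ≡ 0ℤ → + (k ∸ 1) * lambda' (suc M) (suc k) x y ≡ base
        recurrence-vanishing T≡0 = trans (recurrence-with T≡0) (drop base (+ (k ∸ 1)) (+ (2 ^ (k ∸ 2))))
          where drop : ∀ X Y Z → X + Y * (Z * 0ℤ) ≡ X
                drop = solve-∀

        binomial≡ : + (2 ^ (k ∸ 2)) * + (suc a C (k / 2 ∸ 1)) ≡ binomial
        binomial≡ = trans (sym (ℤₚ.pos-* (2 ^ (k ∸ 2)) _))
                          (cong (λ b → + (2 ^ (k ∸ 2) ℕ.* (b C (k / 2 ∸ 1)))) (sym (cong (_∸ 2) 2^M≡3+a)))

      lambda'-recurrence-odd : k % 4 ≡ 1 ⊎ k % 4 ≡ 3 → + (k ∸ 1) * lambda' (suc M) (suc k) x y ≡ base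
      lambda'-recurrence-odd (inj₁ k%4≡1) = recurrence-vanishing (poly-diag-1mod4 (suc a) k 3≤k k%4≡1)
      lambda'-recurrence-odd (inj₂ k%4≡3) = recurrence-vanishing (poly-diag-3mod4 (suc a) k k%4≡3)

      lambda'-recurrence-2mod4 : k % 4 ≡ 2 → + (k ∸ 1) * lambda' (suc M) (suc k) x y ≡ base + + (k ∸ 1) * binomial
      lambda'-recurrence-2mod4 k%4≡2 =
        trans (recurrence-with (poly-diag-2mod4 (suc a) k k%4≡2)) (cong (λ c → base + + (k ∸ 1) * c) binomial≡)

      lambda'-recurrence-0mod4 : k % 4 ≡ 0 → + (k ∸ 1) * lambda' (suc M) (suc k) x y ≡ base - + (k ∸ 1) * binomial
      lambda'-recurrence-0mod4 k%4≡0 = trans (recurrence-with (poly-diag-0mod4 (suc a) k 3≤k k%4≡0))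
        (trans (negate base (+ (k ∸ 1)) (+ (2 ^ (k ∸ 2))) _) (cong (λ c → base - + (k ∸ 1) * c) binomial≡))
        where negate : ∀ X Y Z C → X + Y * (Z * - C) ≡ X - Y * (Z * C)
              negate = solve-∀

  2^[2+n]≡3+odd : ∀ n → ∃[ u ] 2 ^ (2 ℕ.+ n) ≡ 3 ℕ.+ suc (u ℕ.+ u)
  2^[2+n]≡3+odd n with 2 ^ n | ℕₚ.m^n>0 2 n
  ... | suc w | _ = w ℕ.+ w , quadruple w
    where quadruple : ∀ w → 2 ℕ.* (2 ℕ.* suc w) ≡ 3 ℕ.+ suc (w ℕ.+ w ℕ.+ (w ℕ.+ w))
          quadruple = ℕ-Solver.solve-∀

open import Data.Nat using (ℕ; suc; _≤_; _∸_; _^_; _*_; _+_; _/_; _%_; s≤s)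
open import Data.Nat.Combinatorics using (_C_)
open import Data.Integer using (ℤ; +_) renaming (_*_ to _*ℤ_; _+_ to _+ℤ_; _-_ to _-ℤ_)
open import Data.Sum using (_⊎_)
open import Data.Product using (_×_; _,_)
open import Relation.Binary.PropositionalEquality using (_≡_; _≢_)

corollary3p5 : (m : ℕ) → 3 ≤ m → (x y : F2m m) → x ≢ 𝟎 → y ≢ 𝟎 → x ≢ y →
    (k : ℕ) → 3 ≤ k → k ≤ 2 ^ m ∸ 4 →
      ((k % 4 ≡ 1 ⊎ k % 4 ≡ 3) →
        (+ (k ∸ 1)) *ℤ lambda' m (suc k) x y
          ≡ (+ (2 ^ (m + 1) ∸ 2 * k ∸ 2)) *ℤ lambda' m k x y)
    × (k % 4 ≡ 2 →
        (+ (k ∸ 1)) *ℤ lambda' m (suc k) x y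
          ≡ ((+ (2 ^ (m + 1) ∸ 2 * k ∸ 2)) *ℤ lambda' m k x y)
            +ℤ (+ (k ∸ 1)) *ℤ (+ (2 ^ (k ∸ 2) * ((2 ^ (m ∸ 1) ∸ 2) C (k / 2 ∸ 1)))))
    × (k % 4 ≡ 0 →
        (+ (k ∸ 1)) *ℤ lambda' m (suc k) x y
          ≡ ((+ (2 ^ (m + 1) ∸ 2 * k ∸ 2)) *ℤ lambda' m k x y)
            -ℤ (+ (k ∸ 1)) *ℤ (+ (2 ^ (k ∸ 2) * ((2 ^ (m ∸ 1) ∸ 2) C (k / 2 ∸ 1)))))
corollary3p5 (suc (suc (suc n))) (s≤s (s≤s (s≤s _))) x y x≢𝟎 y≢𝟎 x≢y k 3≤k k≤2^m∸4
  with u , 2^M≡3+a ← 2^[2+n]≡3+odd n =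
    lambda'-recurrence-odd k 3≤k k≤2^m∸4 , lambda'-recurrence-2mod4 k 3≤k k≤2^m∸4 , lambda'-recurrence-0mod4 k 3≤k k≤2^m∸4
  where open LambdaRecurrence (2 + n) u 2^M≡3+a x≢𝟎 y≢𝟎 x≢y
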